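{- Let $n$ and $k$ be positive integers with $k\geq 4$, and let $c:E(K_{2kn})\to[k]$ be an edge-coloring (not necessarily proper) of the complete graph $K_{2kn}$ such that the origin lies in the convex hull of $\{v(M):M\in\mathcal{M}\}$. If $M_1$ and $M_2$ are two perfect matchings of $K_{2kn}$, then there is a perfect matching $M_2'$ of $K_{2kn}$ and a collection $\mathcal{C}$ of pairwise vertex-disjoint subgraphs of $K_{2kn}$ such that (i) $M_2'=M_1\,\Delta\, E\left(\bigcup_{C\in\mathcal{C}}C\right)$; (ii) $\|v(M_2)-v(M_2')\|_1\leq 2\sqrt{kn}$; (iii) $|\mathcal{C}|\leq 3\sqrt{kn}$; (iv) every $C\in\mathcal{C}$ is the union of vertex-disjoint $M_1$-alternating cycles and satisfies $m(C)\leq 5\sqrt{kn}$.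
   Context: $\mathcal{M}$ denotes the set of all perfect matchings of $K_{2kn}$. For $M\in\mathcal{M}$ and $i\in[k]$, $m_i(M)=|c^{ -1}(i)\cap M|$ and $v(M)=(m_1(M)-n,\ldots,m_k(M)-n)\in\mathbb{R}^k$; $\|\cdot\|_1$ is the Manhattan norm. $\Delta$ denotes symmetric difference of edge sets, $E(H)$ the edge set of a graph $H$, and $m(C)$ the number of edges of $C$. An $M_1$-alternating cycle is a cycle whose edges alternate between edges in $M_1$ and edges not in $M_1$. -}

module Defs where

open import Data.Nat as ℕ using (ℕ; _+_; _*_; _≤_; _^_)
open import Data.Integer as ℤ using (ℤ; +_; ∣_∣) renaming (_-_ to _-ℤ_)
open import Data.Rational as ℚ using (ℚ; 0ℚ; 1ℚ) renaming (_/_ to _/ℚ_)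
open import Data.Fin using (Fin; toℕ)
open import Data.Fin.Properties using () renaming (_≟_ to _≟ᶠ_)
open import Data.Bool using (Bool; true; false; _∧_; _∨_; if_then_else_; _xor_)
open import Data.List using (List; []; _∷_; _++_; [_]; map; concat; concatMap; zip; foldr; length; allFin)
open import Data.Bool.ListAction using (any)
open import Data.List.Membership.Propositional using (_∈_)
open import Data.List.Relation.Unary.All using (All)
open import Data.List.Relation.Unary.Unique.Propositional using (Unique)
open import Data.List.Relation.Unary.AllPairs using (AllPairs)
open import Data.Product using (Σ; _×_; _,_; ∃)
open import Data.Empty using (⊥)
open import Relation.Nullary using (¬_)
open import Relation.Nullary.Decidable using (⌊_⌋)
open import Relation.Binary.PropositionalEquality using (_≡_; _≢_)

countB : List Bool → ℕ
countB = foldr (λ b acc → (if b then 1 else 0) + acc) 0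

sumℕ : List ℕ → ℕ
sumℕ = foldr _+_ 0

sumℚ : List ℚ → ℚ
sumℚ = foldr ℚ._+_ 0ℚ

edgeList : (N : ℕ) → List (Fin N × Fin N)
edgeList N = concatMap (λ i → concatMap (λ j →
               if ⌊ toℕ i ℕ.<? toℕ j ⌋ then [ (i , j) ] else []) (allFin N)) (allFin N)

EdgeSet : ℕ → Set
EdgeSet N = Fin N → Fin N → Bool

IsEdgeSet : {N : ℕ} → EdgeSet N → Set
IsEdgeSet {N} E = (∀ u v → E u v ≡ E v u) × (∀ v → E v v ≡ false)

numEdges : {N : ℕ} → EdgeSet N → ℕ
numEdges {N} E = countB (map (λ { (i , j) → E i j }) (edgeList N))

deg : {N : ℕ} → EdgeSet N → Fin N → ℕ
deg {N} E v = countB (map (E v) (allFin N))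

IsPerfectMatching : {N : ℕ} → EdgeSet N → Set
IsPerfectMatching M = IsEdgeSet M × (∀ v → deg M v ≡ 1)

-- Edge colourings c : E(K_N) → [k].  Colours are Fin k; the colour of
-- the edge {i,j} (toℕ i < toℕ j) is c i j (other values of c unused).

Coloring : ℕ → ℕ → Set
Coloring N k = Fin N → Fin N → Fin k

mcol : {N k : ℕ} → Coloring N k → EdgeSet N → Fin k → ℕ
mcol {N} c M i =
  countB (map (λ { (a , b) → M a b ∧ ⌊ c a b ≟ᶠ i ⌋ }) (edgeList N))

vec : {N k : ℕ} → ℕ → Coloring N k → EdgeSet N → Fin k → ℤ
vec n c M i = + mcol c M i -ℤ + n

l1dist : {N k : ℕ} → ℕ → Coloring N k → EdgeSet N → EdgeSet N → ℕ
l1dist {N} {k} n c M M' =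
  sumℕ (map (λ i → ∣ vec n c M i -ℤ vec n c M' i ∣) (allFin k))

OriginInHull : (N k n : ℕ) → Coloring N k → Set
OriginInHull N k n c =
  Σ (List (ℚ × EdgeSet N)) λ L →
    All (λ { (w , M) → IsPerfectMatching M × 0ℚ ℚ.≤ w }) L ×
    sumℚ (map (λ { (w , M) → w }) L) ≡ 1ℚ ×
    (∀ (i : Fin k) →
       sumℚ (map (λ { (w , M) → w ℚ.* (vec n c M i /ℚ 1) }) L) ≡ 0ℚ)

cyclePairs : {A : Set} → List A → List (A × A)
cyclePairs []       = []
cyclePairs (x ∷ xs) = zip (x ∷ xs) (xs ++ [ x ])

IsCycle : {N : ℕ} → List (Fin N) → Set
IsCycle vs = 3 ≤ length vs × Unique vs

IsAltCycle : {N : ℕ} → EdgeSet N → List (Fin N) → Set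
IsAltCycle M₁ vs =
  IsCycle vs ×
  All (λ { (b , b') → b ≢ b' })
      (cyclePairs (map (λ { (a , b) → M₁ a b }) (cyclePairs vs)))

cycleEdges : {N : ℕ} → List (Fin N) → EdgeSet N
cycleEdges vs u v = any (λ { (a , b) →
  (⌊ a ≟ᶠ u ⌋ ∧ ⌊ b ≟ᶠ v ⌋) ∨ (⌊ a ≟ᶠ v ⌋ ∧ ⌊ b ≟ᶠ u ⌋) }) (cyclePairs vs)

Disjoint : {N : ℕ} → List (Fin N) → List (Fin N) → Set
Disjoint xs ys = ∀ x → x ∈ xs → x ∈ ys → ⊥

-- A subgraph C given as a union of cycles (list of cycles).

Subgraph : ℕ → Set
Subgraph N = List (List (Fin N))

subEdges : {N : ℕ} → Subgraph N → EdgeSet N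
subEdges C u v = any (λ cyc → cycleEdges cyc u v) C

subVertices : {N : ℕ} → Subgraph N → List (Fin N)
subVertices C = concat C

IsUnionAltCycles : {N : ℕ} → EdgeSet N → Subgraph N → Set
IsUnionAltCycles M₁ C = All (IsAltCycle M₁) C × AllPairs Disjoint C

unionEdges : {N : ℕ} → List (Subgraph N) → EdgeSet N
unionEdges 𝒞 u v = any (λ C → subEdges C u v) 𝒞

module Submission where

-- Write M₁ and M₂ as fixed-point-free involutions p₁ and p₂. The orbits of p₂ ∘ p₁ on the vertices
-- it moves are the cycles of M₁ Δ M₂, each recorded as the list of its M₁-edges. Let
-- Q = ⌊(5/2)√(kn)⌋ and h = ⌈Q/2⌉. A cycle with more than Q M₁-edges is cut into pieces of h
-- M₁-edges and a last piece of between h and Q; closing a piece by one chord makes it an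
-- M₁-alternating cycle all of whose other edges lie in M₂. Trading the M₁-edges of every piece for
-- its other edges gives M₂', which differs from M₂ only at the chords. There are at most kn
-- M₁-edges in all and every chord closes a piece of at least h of them, so there are at most
-- kn/h ≤ √(kn) chords, and ‖v(M₂) - v(M₂')‖₁ is at most twice their number. Finally the pieces
-- are packed into groups of at most Q M₁-edges (hence at most 2Q ≤ 5√(kn) edges), all but the
-- last of size at least h, which bounds the number of groups by 3√(kn).

open import Defs
open import Function using (_∘_; id)
open import Data.Nat as ℕ using (ℕ; zero; suc; _+_; _*_; _∸_; _^_; _≤_; _<_; _≤?_; z≤n; s≤s)
open import Data.Nat.Properties as ℕₚ
open import Data.Nat.Solver using (module +-*-Solver)
open import Data.Integer as ℤ using (∣_∣) renaming (_-_ to _-ℤ_)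
import Data.Integer.Properties as ℤₚ
import Data.Integer.Solver as ℤ-Solver
open import Data.Fin as Fin using (Fin; toℕ)
open import Data.Fin.Properties using (pigeonhole; toℕ<n)
  renaming (_≟_ to _≟ᶠ_; suc-injective to Fin-suc-injective)
open import Data.Bool using (Bool; true; false; _∧_; _∨_; not; if_then_else_; _xor_)
open import Data.Bool.Properties using (∧-distribˡ-∨; ∧-zeroʳ; ∨-zeroʳ; xor-identityʳ)
open import Data.Bool.ListAction using (any)
open import Data.Maybe using (Maybe; just; nothing; fromMaybe)
open import Data.List
  using (List; []; _∷_; _++_; [_]; map; concat; concatMap; allFin; tabulate; length; zip; take; drop; filterᵇ)
import Data.List.Properties as Listₚ
open import Data.List.Membership.Propositional using (_∈_; _∉_)
import Data.List.Membership.Propositional.Properties as ∈ₚ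
open import Data.List.Relation.Unary.Any using (here; there)
open import Data.List.Relation.Unary.All as All using (All; []; _∷_)
import Data.List.Relation.Unary.All.Properties as Allₚ
open import Data.List.Relation.Unary.AllPairs using (AllPairs; []; _∷_)
import Data.List.Relation.Unary.AllPairs.Properties as AllPairsₚ
open import Data.List.Relation.Unary.Unique.Propositional using (Unique)
open import Data.Product using (Σ; ∃; _×_; _,_; proj₁; proj₂)
open import Data.Sum using (_⊎_; inj₁; inj₂)
open import Data.Unit using (⊤; tt)
open import Data.Empty using (⊥; ⊥-elim)
open import Relation.Nullary using (¬_; Dec; yes; no)
open import Relation.Nullary.Decidable using (⌊_⌋)
open import Relation.Binary.PropositionalEquality
  using (_≡_; _≢_; refl; sym; trans; cong; cong₂; subst; subst₂; module ≡-Reasoning)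
open import Algebra.Properties.CommutativeMonoid.Sum ℕₚ.+-0-commutativeMonoid
  using (sum; ∑-distrib-+; sum-cong-≗)
open import Algebra.Properties.CommutativeSemigroup ℕₚ.+-commutativeSemigroup
  using (interchange; x∙yz≈y∙xz)

indicator : Bool → ℕ
indicator true  = 1
indicator false = 0

indicator≤1 : ∀ b → indicator b ≤ 1
indicator≤1 true  = s≤s z≤n
indicator≤1 false = z≤n

indicator-mono : ∀ a b → (a ≡ true → b ≡ true) → indicator a ≤ indicator b
indicator-mono false b _ = z≤n
indicator-mono true  b f rewrite f refl = s≤s z≤n

countB-∷ : ∀ b bs → countB (b ∷ bs) ≡ indicator b + countB bs
countB-∷ true  bs = refl
countB-∷ false bs = refl

countB-++ : ∀ xs ys → countB (xs ++ ys) ≡ countB xs + countB ys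
countB-++ []           ys = refl
countB-++ (true ∷ xs)  ys = cong suc (countB-++ xs ys)
countB-++ (false ∷ xs) ys = countB-++ xs ys

countB-concatMap : {A B : Set} (P : B → Bool) (f : A → List B) (xs : List A) →
  countB (map P (concatMap f xs)) ≡ sumℕ (map (λ x → countB (map P (f x))) xs)
countB-concatMap P f []       = refl
countB-concatMap P f (x ∷ xs) = begin
  countB (map P (f x ++ concatMap f xs))                ≡⟨ cong countB (Listₚ.map-++ P (f x) _) ⟩
  countB (map P (f x) ++ map P (concatMap f xs))        ≡⟨ countB-++ (map P (f x)) _ ⟩
  countB (map P (f x)) + countB (map P (concatMap f xs)) ≡⟨ cong (countB (map P (f x)) +_) (countB-concatMap P f xs) ⟩
  _ ∎
  where open ≡-Reasoning

sumℕ-tabulate : ∀ {n} (f : Fin n → ℕ) → sumℕ (tabulate f) ≡ sum f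
sumℕ-tabulate {zero}  f = refl
sumℕ-tabulate {suc n} f = cong (f Fin.zero +_) (sumℕ-tabulate (f ∘ Fin.suc))

sumℕ-map-allFin : ∀ {n} (f : Fin n → ℕ) → sumℕ (map f (allFin n)) ≡ sum f
sumℕ-map-allFin f = trans (cong sumℕ (Listₚ.map-tabulate id f)) (sumℕ-tabulate f)

countB-map : {A : Set} (f : A → Bool) (xs : List A) → countB (map f xs) ≡ sumℕ (map (indicator ∘ f) xs)
countB-map f []       = refl
countB-map f (x ∷ xs) = trans (countB-∷ (f x) (map f xs)) (cong (indicator (f x) +_) (countB-map f xs))

countB-map-allFin : ∀ {n} (f : Fin n → Bool) → countB (map f (allFin n)) ≡ sum (indicator ∘ f)
countB-map-allFin f = trans (countB-map f (allFin _)) (sumℕ-map-allFin (indicator ∘ f))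

sum-mono : ∀ {n} {f g : Fin n → ℕ} → (∀ i → f i ≤ g i) → sum f ≤ sum g
sum-mono {zero}  f≤g = z≤n
sum-mono {suc n} f≤g = +-mono-≤ (f≤g Fin.zero) (sum-mono (f≤g ∘ Fin.suc))

sum-zero : ∀ {n} (f : Fin n → ℕ) → (∀ i → f i ≡ 0) → sum f ≡ 0
sum-zero {zero}  f f≡0 = refl
sum-zero {suc n} f f≡0 = cong₂ _+_ (f≡0 Fin.zero) (sum-zero (f ∘ Fin.suc) (f≡0 ∘ Fin.suc))

sum-single : ∀ {n} (f : Fin n → ℕ) (b : Fin n) → (∀ j → j ≢ b → f j ≡ 0) → sum f ≡ f b
sum-single f Fin.zero f≡0 =
  trans (cong (f Fin.zero +_) (sum-zero _ (λ i → f≡0 (Fin.suc i) (λ ())))) (+-identityʳ _)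
sum-single f (Fin.suc b) f≡0 = cong₂ _+_ (f≡0 Fin.zero (λ ()))
  (sum-single (f ∘ Fin.suc) b (λ j j≢b → f≡0 (Fin.suc j) (j≢b ∘ Fin-suc-injective)))

≤-sum : ∀ {n} (f : Fin n → ℕ) (j : Fin n) → f j ≤ sum f
≤-sum f Fin.zero    = m≤m+n _ _
≤-sum f (Fin.suc j) = ≤-trans (≤-sum (f ∘ Fin.suc) j) (m≤n+m _ _)

sum-one : ∀ n → sum {n} (λ _ → 1) ≡ n
sum-one zero    = refl
sum-one (suc n) = cong suc (sum-one n)

count≡1⇒unique : ∀ {n} (f : Fin n → Bool) → sum (indicator ∘ f) ≡ 1 →
  Σ (Fin n) λ b → f b ≡ true × (∀ j → f j ≡ true → j ≡ b)
count≡1⇒unique {suc n} f sum≡1 with f Fin.zero in f0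
... | true = Fin.zero , f0 , only-zero
  where
  only-zero : ∀ j → f j ≡ true → j ≡ Fin.zero
  only-zero Fin.zero    _   = refl
  only-zero (Fin.suc j) fj with f (Fin.suc j) | ≤-sum (indicator ∘ f ∘ Fin.suc) j
  ... | true | 1≤rest with suc-injective sum≡1
  ...   | rest≡0 = ⊥-elim (<-irrefl refl (≤-trans 1≤rest (≤-reflexive rest≡0)))
... | false with count≡1⇒unique (f ∘ Fin.suc) sum≡1
...   | b , fb , only-b = Fin.suc b , fb , only-suc-b
  where
  only-suc-b : ∀ j → f j ≡ true → j ≡ Fin.suc b
  only-suc-b Fin.zero    fj = case (trans (sym f0) fj)
    where case : false ≡ true → _
          case ()
  only-suc-b (Fin.suc j) fj = cong Fin.suc (only-b j fj)

ordered : ∀ {N} → Fin N → Fin N → Bool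
ordered i j = ⌊ toℕ i ℕ.<? toℕ j ⌋

countB-edgeList : (N : ℕ) (P : Fin N × Fin N → Bool) →
  countB (map P (edgeList N)) ≡ sum (λ i → sum (λ j → indicator (ordered i j ∧ P (i , j))))
countB-edgeList N P = begin
  countB (map P (edgeList N))
    ≡⟨ countB-concatMap P row (allFin N) ⟩
  sumℕ (map (λ i → countB (map P (row i))) (allFin N))
    ≡⟨ sumℕ-map-allFin (λ i → countB (map P (row i))) ⟩
  sum (λ i → countB (map P (row i)))
    ≡⟨ sum-cong-≗ (λ i → trans (countB-concatMap P (entry i) (allFin N))
                       (trans (sumℕ-map-allFin (λ j → countB (map P (entry i j))))
                              (sum-cong-≗ (λ j → countB-entry (ordered i j) (i , j))))) ⟩
  sum (λ i → sum (λ j → indicator (ordered i j ∧ P (i , j)))) ∎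
  where
  open ≡-Reasoning
  entry : Fin N → Fin N → List (Fin N × Fin N)
  entry i j = if ordered i j then [ (i , j) ] else []
  row : Fin N → List (Fin N × Fin N)
  row i = concatMap (entry i) (allFin N)
  countB-entry : ∀ b e → countB (map P (if b then [ e ] else [])) ≡ indicator (b ∧ P e)
  countB-entry false e = refl
  countB-entry true  e = trans (countB-∷ (P e) []) (+-identityʳ _)

_==_ : ∀ {N} → Fin N → Fin N → Bool
u == v = ⌊ u ≟ᶠ v ⌋

==-refl : ∀ {N} (u : Fin N) → (u == u) ≡ true
==-refl u with u ≟ᶠ u
... | yes _  = refl
... | no u≢u = ⊥-elim (u≢u refl)

==⇒≡ : ∀ {N} {u v : Fin N} → (u == v) ≡ true → u ≡ v
==⇒≡ {u = u} {v} eq with u ≟ᶠ v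
... | yes u≡v = u≡v

≢⇒==-false : ∀ {N} {u v : Fin N} → u ≢ v → (u == v) ≡ false
≢⇒==-false {u = u} {v} u≢v with u ≟ᶠ v
... | yes u≡v = ⊥-elim (u≢v u≡v)
... | no _    = refl

sum-indicator-== : ∀ {N} (b : Fin N) → sum (λ j → indicator (b == j)) ≡ 1
sum-indicator-== b = trans (sum-single _ b (λ j j≢b → cong indicator (≢⇒==-false (j≢b ∘ sym))))
                           (cong indicator (==-refl b))

-- Perfect matchings as fixed-point-free involutions
record IsFreeInvolution {N : ℕ} (p : Fin N → Fin N) : Set where
  field
    involutive     : ∀ u → p (p u) ≡ u
    fixedPointFree : ∀ u → p u ≢ u
open IsFreeInvolution public

matchingOf : ∀ {N} → (Fin N → Fin N) → EdgeSet N
matchingOf p u v = p u == v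

involution-swap : ∀ {N} {p : Fin N → Fin N} → IsFreeInvolution p → ∀ {u v} → p u ≡ v → p v ≡ u
involution-swap I {u} refl = involutive I u

matchingOf-sym : ∀ {N} {p : Fin N → Fin N} → IsFreeInvolution p → ∀ u v → matchingOf p u v ≡ matchingOf p v u
matchingOf-sym {p = p} I u v with p u ≟ᶠ v | p v ≟ᶠ u
... | yes _   | yes _   = refl
... | no _    | no _    = refl
... | yes puv | no pvu  = ⊥-elim (pvu (involution-swap I puv))
... | no puv  | yes pvu = ⊥-elim (puv (involution-swap I pvu))

matchingOf-isPerfectMatching : ∀ {N} {p : Fin N → Fin N} → IsFreeInvolution p →
  IsPerfectMatching (matchingOf p)
matchingOf-isPerfectMatching {p = p} I =
  (matchingOf-sym I , λ v → ≢⇒==-false (fixedPointFree I v)) ,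
  λ v → trans (countB-map-allFin (matchingOf p v)) (sum-indicator-== (p v))

perfectMatching⇒involution : ∀ {N} (M : EdgeSet N) → IsPerfectMatching M →
  Σ (Fin N → Fin N) λ p → IsFreeInvolution p × (∀ u v → M u v ≡ matchingOf p u v)
perfectMatching⇒involution {N} M ((M-sym , M-loopless) , deg≡1) =
  partner , record { involutive = involutive′ ; fixedPointFree = fixedPointFree′ } , M≡
  where
  unique-neighbour : ∀ u → Σ (Fin N) λ b → M u b ≡ true × (∀ j → M u j ≡ true → j ≡ b)
  unique-neighbour u = count≡1⇒unique (M u) (trans (sym (countB-map-allFin (M u))) (deg≡1 u))
  partner : Fin N → Fin N
  partner u = proj₁ (unique-neighbour u)
  adjacent : ∀ u → M u (partner u) ≡ true
  adjacent u = proj₁ (proj₂ (unique-neighbour u))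
  only : ∀ u v → M u v ≡ true → v ≡ partner u
  only u = proj₂ (proj₂ (unique-neighbour u))
  M≡ : ∀ u v → M u v ≡ matchingOf partner u v
  M≡ u v with M u v in Muv | partner u ≟ᶠ v
  ... | true  | yes _ = refl
  ... | true  | no pu≢v = ⊥-elim (pu≢v (sym (only u v Muv)))
  ... | false | no _ = refl
  ... | false | yes refl with trans (sym Muv) (adjacent u)
  ...   | ()
  involutive′ : ∀ u → partner (partner u) ≡ u
  involutive′ u = sym (only (partner u) u (trans (M-sym (partner u) u) (adjacent u)))
  fixedPointFree′ : ∀ u → partner u ≢ u
  fixedPointFree′ u pu≡u with trans (sym (M-loopless u)) (subst (λ w → M u w ≡ true) pu≡u (adjacent u))
  ... | ()

occ : ∀ {N} → Fin N → List (Fin N) → ℕ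
occ y xs = countB (map (y ==_) xs)

record Distinct {N : ℕ} (xs : List (Fin N)) : Set where
  constructor distinct
  field occ≤1 : ∀ y → occ y xs ≤ 1
open Distinct public

module _ {N : ℕ} where

  occ-∷ : (y x : Fin N) (xs : List (Fin N)) → occ y (x ∷ xs) ≡ indicator (y == x) + occ y xs
  occ-∷ y x xs = countB-∷ (y == x) (map (y ==_) xs)

  occ-++ : (y : Fin N) (xs ys : List (Fin N)) → occ y (xs ++ ys) ≡ occ y xs + occ y ys
  occ-++ y xs ys = trans (cong countB (Listₚ.map-++ (y ==_) xs ys)) (countB-++ (map (y ==_) xs) _)

  occ-self : (y : Fin N) (xs : List (Fin N)) → occ y (y ∷ xs) ≡ suc (occ y xs)
  occ-self y xs = trans (occ-∷ y y xs) (cong (λ b → indicator b + occ y xs) (==-refl y))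

  ∈⇒occ≥1 : {y : Fin N} {xs : List (Fin N)} → y ∈ xs → 1 ≤ occ y xs
  ∈⇒occ≥1 {y} {_ ∷ xs} (here refl) rewrite occ-self y xs = s≤s z≤n
  ∈⇒occ≥1 {y} {x ∷ xs} (there y∈xs) rewrite occ-∷ y x xs = ≤-trans (∈⇒occ≥1 y∈xs) (m≤n+m _ _)

  occ≥1⇒∈ : {y : Fin N} (xs : List (Fin N)) → 1 ≤ occ y xs → y ∈ xs
  occ≥1⇒∈ {y} (x ∷ xs) 1≤occ with y ≟ᶠ x
  ... | yes y≡x = here y≡x
  ... | no _    = there (occ≥1⇒∈ xs 1≤occ)

  occ≡0⇒∉ : {y : Fin N} (xs : List (Fin N)) → occ y xs ≡ 0 → y ∉ xs
  occ≡0⇒∉ xs occ≡0 y∈xs with subst (1 ≤_) occ≡0 (∈⇒occ≥1 y∈xs)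
  ... | ()

  ∉⊎∈ : (y : Fin N) (xs : List (Fin N)) → (y ∉ xs) ⊎ (y ∈ xs)
  ∉⊎∈ y xs with occ y xs in eq
  ... | zero  = inj₁ (occ≡0⇒∉ xs eq)
  ... | suc _ = inj₂ (occ≥1⇒∈ xs (subst (1 ≤_) (sym eq) (s≤s z≤n)))

  ∈×∈⇒occ≥2 : {y : Fin N} (xs ys : List (Fin N)) → y ∈ xs → y ∈ ys → 2 ≤ occ y (xs ++ ys)
  ∈×∈⇒occ≥2 {y} xs ys y∈xs y∈ys =
    subst (2 ≤_) (sym (occ-++ y xs ys)) (+-mono-≤ (∈⇒occ≥1 y∈xs) (∈⇒occ≥1 y∈ys))

  Distinct-∷⁻ : {x : Fin N} {xs : List (Fin N)} → Distinct (x ∷ xs) → Distinct xs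
  Distinct-∷⁻ {x} {xs} dist = distinct λ y → ≤-trans (m≤n+m _ _) (subst (_≤ 1) (occ-∷ y x xs) (occ≤1 dist y))

  Distinct⇒∉ : {x : Fin N} {xs : List (Fin N)} → Distinct (x ∷ xs) → x ∉ xs
  Distinct⇒∉ {x} {xs} dist x∈xs with subst (_≤ 1) (occ-self x xs) (occ≤1 dist x)
  ... | s≤s occ≤0 with ≤-trans (∈⇒occ≥1 x∈xs) occ≤0
  ...   | ()

  ∉⇒occ≡0 : {y : Fin N} (xs : List (Fin N)) → y ∉ xs → occ y xs ≡ 0
  ∉⇒occ≡0 {y} xs y∉xs with occ y xs in eq
  ... | zero  = refl
  ... | suc _ = ⊥-elim (y∉xs (occ≥1⇒∈ xs (subst (1 ≤_) (sym eq) (s≤s z≤n))))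

  Distinct-∷⁺ : {x : Fin N} {xs : List (Fin N)} → x ∉ xs → Distinct xs → Distinct (x ∷ xs)
  Distinct-∷⁺ {x} {xs} x∉xs dist = distinct λ y → by-cases y (y ≟ᶠ x)
    where
    by-cases : ∀ y → Dec (y ≡ x) → occ y (x ∷ xs) ≤ 1
    by-cases y (yes refl) = subst (_≤ 1) (sym (occ-self y xs)) (s≤s (≤-reflexive (∉⇒occ≡0 xs x∉xs)))
    by-cases y (no y≢x)   = subst (_≤ 1) (sym (occ-∷ y x xs))
                            (subst (λ b → indicator b + occ y xs ≤ 1) (sym (≢⇒==-false y≢x)) (occ≤1 dist y))

  Distinct-++⁻ʳ : (xs ys : List (Fin N)) → Distinct (xs ++ ys) → Distinct ys
  Distinct-++⁻ʳ xs ys dist = distinct λ y → ≤-trans (m≤n+m _ _) (subst (_≤ 1) (occ-++ y xs ys) (occ≤1 dist y))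

  Distinct-++⇒Disjoint : (xs ys : List (Fin N)) → Distinct (xs ++ ys) → Disjoint xs ys
  Distinct-++⇒Disjoint xs ys dist y y∈xs y∈ys with ≤-trans (∈×∈⇒occ≥2 xs ys y∈xs y∈ys) (occ≤1 dist y)
  ... | s≤s ()

  Distinct-++⁺ : (xs ys : List (Fin N)) → Distinct xs → Distinct ys → Disjoint xs ys → Distinct (xs ++ ys)
  Distinct-++⁺ [] ys _ dist-ys _ = dist-ys
  Distinct-++⁺ (x ∷ xs) ys dist-xs dist-ys disj =
    Distinct-∷⁺ x∉ (Distinct-++⁺ xs ys (Distinct-∷⁻ dist-xs) dist-ys (λ y y∈xs → disj y (there y∈xs)))
    where
    x∉ : x ∉ xs ++ ys
    x∉ x∈ with ∈ₚ.∈-++⁻ xs x∈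
    ... | inj₁ x∈xs = Distinct⇒∉ dist-xs x∈xs
    ... | inj₂ x∈ys = disj x (here refl) x∈ys

  Distinct⇒Unique : {xs : List (Fin N)} → Distinct xs → Unique xs
  Distinct⇒Unique {[]}     _    = []
  Distinct⇒Unique {x ∷ xs} dist = all-≢ xs (Distinct⇒∉ dist) ∷ Distinct⇒Unique (Distinct-∷⁻ dist)
    where
    all-≢ : (ys : List (Fin N)) → x ∉ ys → All (x ≢_) ys
    all-≢ []       _    = []
    all-≢ (y ∷ ys) x∉ys = (λ x≡y → x∉ys (here x≡y)) ∷ all-≢ ys (x∉ys ∘ there)

  occ-≤-concat : (y : Fin N) {xs : List (Fin N)} (xss : List (List (Fin N))) → xs ∈ xss →
    occ y xs ≤ occ y (concat xss)
  occ-≤-concat y (xs ∷ xss) (here refl) =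
    ≤-trans (m≤m+n _ _) (≤-reflexive (sym (occ-++ y xs (concat xss))))
  occ-≤-concat y (ys ∷ xss) (there xs∈xss) =
    ≤-trans (occ-≤-concat y xss xs∈xss) (≤-trans (m≤n+m _ _) (≤-reflexive (sym (occ-++ y ys (concat xss)))))

  Distinct-concat⁻ : {xs : List (Fin N)} (xss : List (List (Fin N))) → Distinct (concat xss) → xs ∈ xss → Distinct xs
  Distinct-concat⁻ xss dist xs∈xss = distinct λ y → ≤-trans (occ-≤-concat y xss xs∈xss) (occ≤1 dist y)

  Distinct-concat⇒AllPairs : (xss : List (List (Fin N))) → Distinct (concat xss) → AllPairs Disjoint xss
  Distinct-concat⇒AllPairs []         _    = []
  Distinct-concat⇒AllPairs (xs ∷ xss) dist =
    all-disjoint xss (λ ys∈xss y y∈xs y∈ys → disj y y∈xs (∈ₚ.∈-concat⁺′ y∈ys ys∈xss)) ∷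
    Distinct-concat⇒AllPairs xss (Distinct-++⁻ʳ xs (concat xss) dist)
    where
    disj : Disjoint xs (concat xss)
    disj = Distinct-++⇒Disjoint xs (concat xss) dist
    all-disjoint : (yss : List (List (Fin N))) → (∀ {ys} → ys ∈ yss → Disjoint xs ys) → All (Disjoint xs) yss
    all-disjoint []         _ = []
    all-disjoint (ys ∷ yss) f = f (here refl) ∷ all-disjoint yss (f ∘ there)

  ∑-occ≡length : (xs : List (Fin N)) → sum (λ y → occ y xs) ≡ length xs
  ∑-occ≡length []       = sum-zero {N} (λ y → occ y []) (λ _ → refl)
  ∑-occ≡length (x ∷ xs) = begin
    sum (λ y → occ y (x ∷ xs))                           ≡⟨ sum-cong-≗ (λ y → occ-∷ y x xs) ⟩
    sum (λ y → indicator (y == x) + occ y xs)            ≡⟨ ∑-distrib-+ (λ y → indicator (y == x)) _ ⟩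
    sum (λ y → indicator (y == x)) + sum (λ y → occ y xs) ≡⟨ cong₂ _+_ indicator-x (∑-occ≡length xs) ⟩
    suc (length xs) ∎
    where
    open ≡-Reasoning
    indicator-x : sum (λ y → indicator (y == x)) ≡ 1
    indicator-x = trans (sum-single _ x (λ y y≢x → cong indicator (≢⇒==-false y≢x))) (cong indicator (==-refl x))

  Distinct⇒length≤ : (xs : List (Fin N)) → Distinct xs → length xs ≤ N
  Distinct⇒length≤ xs dist = subst₂ _≤_ (∑-occ≡length xs) (sum-one N) (sum-mono (occ≤1 dist))

∧-true⁻ : ∀ {x y} → (x ∧ y) ≡ true → x ≡ true × y ≡ true
∧-true⁻ {true} {true} _ = refl , refl

∨-true⁻ : ∀ {x y} → (x ∨ y) ≡ true → x ≡ true ⊎ y ≡ true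
∨-true⁻ {true}         _ = inj₁ refl
∨-true⁻ {false} {true} _ = inj₂ refl

∧-true⁺ : ∀ {x y} → x ≡ true → y ≡ true → (x ∧ y) ≡ true
∧-true⁺ refl refl = refl

any-true⁻ : {A : Set} (f : A → Bool) (xs : List A) → any f xs ≡ true → ∃ λ x → x ∈ xs × f x ≡ true
any-true⁻ f (x ∷ xs) any≡true with f x in fx
... | true  = x , here refl , fx
... | false with any-true⁻ f xs any≡true
...   | y , y∈xs , fy = y , there y∈xs , fy

any-true⁺ : {A : Set} (f : A → Bool) {x : A} {xs : List A} → x ∈ xs → f x ≡ true → any f xs ≡ true
any-true⁺ f {xs = y ∷ xs} (here refl) fx rewrite fx = refl
any-true⁺ f {xs = y ∷ xs} (there x∈xs) fx with f y
... | true  = refl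
... | false = any-true⁺ f x∈xs fx

indicator-≤-∨ : ∀ a b c → (a ≡ true → (b ∨ c) ≡ true) → indicator a ≤ indicator b + indicator c
indicator-≤-∨ false b     c     _   = z≤n
indicator-≤-∨ true  true  c     _   = s≤s z≤n
indicator-≤-∨ true  false true  _   = s≤s z≤n
indicator-≤-∨ true  false false imp with imp refl
... | ()

countB-map-≤-∨ : {A : Set} (f g h : A → Bool) (xs : List A) → (∀ x → f x ≡ true → (g x ∨ h x) ≡ true) →
  countB (map f xs) ≤ countB (map g xs) + countB (map h xs)
countB-map-≤-∨ f g h []       _   = z≤n
countB-map-≤-∨ f g h (x ∷ xs) imp = begin
  countB (map f (x ∷ xs))                                      ≡⟨ countB-∷ (f x) (map f xs) ⟩
  indicator (f x) + countB (map f xs)                          ≤⟨ +-mono-≤ (indicator-≤-∨ (f x) (g x) (h x) (imp x))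
                                                                                (countB-map-≤-∨ f g h xs imp) ⟩
  (indicator (g x) + indicator (h x)) + (countB (map g xs) + countB (map h xs))
    ≡⟨ interchange (indicator (g x)) (indicator (h x)) (countB (map g xs)) (countB (map h xs)) ⟩
  (indicator (g x) + countB (map g xs)) + (indicator (h x) + countB (map h xs))
    ≡⟨ sym (cong₂ _+_ (countB-∷ (g x) (map g xs)) (countB-∷ (h x) (map h xs))) ⟩
  countB (map g (x ∷ xs)) + countB (map h (x ∷ xs)) ∎
  where open ≤-Reasoning

module _ {N : ℕ} where

  joins : Fin N × Fin N → Fin N → Fin N → Bool
  joins (a , b) u v = (a == u ∧ b == v) ∨ (a == v ∧ b == u)

  joins-true⁻ : ∀ a b u v → joins (a , b) u v ≡ true → (a ≡ u × b ≡ v) ⊎ (a ≡ v × b ≡ u)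
  joins-true⁻ a b u v j with ∨-true⁻ {a == u ∧ b == v} j
  ... | inj₁ t = let (t₁ , t₂) = ∧-true⁻ {a == u} t in inj₁ (==⇒≡ t₁ , ==⇒≡ t₂)
  ... | inj₂ t = let (t₁ , t₂) = ∧-true⁻ {a == v} t in inj₂ (==⇒≡ t₁ , ==⇒≡ t₂)

  joins-forward : ∀ u v → joins (u , v) u v ≡ true
  joins-forward u v rewrite ==-refl u | ==-refl v = refl

  joins-backward : ∀ u v → joins (v , u) u v ≡ true
  joins-backward u v rewrite ==-refl u | ==-refl v = ∨-zeroʳ _

  ordered-asym : (a b : Fin N) → ordered a b ≡ true → ordered b a ≡ false
  ordered-asym a b _ with toℕ a ℕ.<? toℕ b | toℕ b ℕ.<? toℕ a
  ... | yes a<b | yes b<a = ⊥-elim (<-asym a<b b<a)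
  ... | yes _   | no _    = refl

  point-mass : (x y : Fin N) → sum (λ i → sum (λ j → indicator ((x == i) ∧ (y == j)))) ≡ 1
  point-mass x y =
    trans (sum-single _ x (λ i i≢x → sum-zero _ (λ j →
             cong (λ b → indicator (b ∧ (y == j))) (≢⇒==-false (i≢x ∘ sym)))))
          (trans (sum-cong-≗ (λ j → cong (λ b → indicator (b ∧ (y == j))) (==-refl x))) (sum-indicator-== y))

  ∑∑≤point-mass : (x y : Fin N) (P : Fin N → Fin N → Bool) →
    (∀ i j → P i j ≡ true → ((x == i) ∧ (y == j)) ≡ true) →
    sum (λ i → sum (λ j → indicator (P i j))) ≤ 1
  ∑∑≤point-mass x y P P⇒ = ≤-trans (sum-mono (λ i → sum-mono (λ j → indicator-mono _ _ (P⇒ i j))))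
                                       (≤-reflexive (point-mass x y))

  edges-joined-by-pair≤1 : (e : Fin N × Fin N) → sum (λ i → sum (λ j → indicator (ordered i j ∧ joins e i j))) ≤ 1
  edges-joined-by-pair≤1 (a , b) with ordered a b in ab
  ... | true = ∑∑≤point-mass a b _ only-ab
    where
    only-ab : ∀ i j → (ordered i j ∧ joins (a , b) i j) ≡ true → ((a == i) ∧ (b == j)) ≡ true
    only-ab i j t with ∧-true⁻ {ordered i j} t
    ... | i<j , ij with joins-true⁻ a b i j ij
    ...   | inj₁ (refl , refl) = ∧-true⁺ (==-refl a) (==-refl b)
    ...   | inj₂ (refl , refl) with trans (sym (ordered-asym a b ab)) i<j
    ...     | ()
  ... | false = ∑∑≤point-mass b a _ only-ba
    where
    only-ba : ∀ i j → (ordered i j ∧ joins (a , b) i j) ≡ true → ((b == i) ∧ (a == j)) ≡ true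
    only-ba i j t with ∧-true⁻ {ordered i j} t
    ... | i<j , ij with joins-true⁻ a b i j ij
    ...   | inj₂ (refl , refl) = ∧-true⁺ (==-refl b) (==-refl a)
    ...   | inj₁ (refl , refl) with trans (sym ab) i<j
    ...     | ()

  joinedBy : List (Fin N × Fin N) → Fin N → Fin N → Bool
  joinedBy L i j = any (λ e → joins e i j) L

  edges-joined-by≤length : (L : List (Fin N × Fin N)) →
    sum (λ i → sum (λ j → indicator (ordered i j ∧ joinedBy L i j))) ≤ length L
  edges-joined-by≤length [] =
    ≤-reflexive (sum-zero {N} _ (λ i → sum-zero {N} _ (λ j → cong indicator (∧-zeroʳ (ordered i j)))))
  edges-joined-by≤length (e ∷ L) = begin
    sum (λ i → sum (λ j → indicator (ordered i j ∧ joinedBy (e ∷ L) i j)))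
      ≤⟨ sum-mono (λ i → sum-mono (λ j → indicator-≤-∨ _ (ordered i j ∧ joins e i j) (ordered i j ∧ joinedBy L i j)
                                              (trans (sym (∧-distribˡ-∨ (ordered i j) (joins e i j) (joinedBy L i j)))))) ⟩
    sum (λ i → sum (λ j → ind-e i j + ind-L i j))
      ≡⟨ sum-cong-≗ (λ i → ∑-distrib-+ (ind-e i) (ind-L i)) ⟩
    sum (λ i → sum (ind-e i) + sum (ind-L i))
      ≡⟨ ∑-distrib-+ (λ i → sum (ind-e i)) (λ i → sum (ind-L i)) ⟩
    sum (λ i → sum (ind-e i)) + sum (λ i → sum (ind-L i))
      ≤⟨ +-mono-≤ (edges-joined-by-pair≤1 e) (edges-joined-by≤length L) ⟩
    suc (length L) ∎
    where
    open ≤-Reasoning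
    ind-e ind-L : Fin N → Fin N → ℕ
    ind-e i j = indicator (ordered i j ∧ joins e i j)
    ind-L i j = indicator (ordered i j ∧ joinedBy L i j)

  numEdges≤cover : (E : EdgeSet N) (L : List (Fin N × Fin N)) →
    (∀ u v → E u v ≡ true → ∃ λ e → e ∈ L × joins e u v ≡ true) → numEdges E ≤ length L
  numEdges≤cover E L covered = begin
    numEdges E
      ≡⟨ countB-edgeList N (λ e → E (proj₁ e) (proj₂ e)) ⟩
    sum (λ i → sum (λ j → indicator (ordered i j ∧ E i j)))
      ≤⟨ sum-mono (λ i → sum-mono (λ j → indicator-mono _ _ (joined i j))) ⟩
    sum (λ i → sum (λ j → indicator (ordered i j ∧ joinedBy L i j)))
      ≤⟨ edges-joined-by≤length L ⟩
    length L ∎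
    where
    open ≤-Reasoning
    joined : ∀ i j → (ordered i j ∧ E i j) ≡ true → (ordered i j ∧ joinedBy L i j) ≡ true
    joined i j t with ∧-true⁻ {ordered i j} t
    ... | i<j , Eij with covered i j Eij
    ...   | e , e∈L , joins-e = ∧-true⁺ i<j (any-true⁺ (λ e → joins e i j) e∈L joins-e)

  _∖_ : EdgeSet N → EdgeSet N → EdgeSet N
  (E ∖ F) u v = E u v ∧ not (F u v)

vec-difference : (a b n : ℕ) → (ℤ.+ a -ℤ ℤ.+ n) -ℤ (ℤ.+ b -ℤ ℤ.+ n) ≡ ℤ.+ a -ℤ ℤ.+ b
vec-difference a b n = solve 3 (λ x y z → (x :- z) :- (y :- z) := x :- y) refl (ℤ.+ a) (ℤ.+ b) (ℤ.+ n)
  where open ℤ-Solver.+-*-Solver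

∣vec-vec∣≤ : (a b n A B : ℕ) → a ≤ b + A → b ≤ a + B →
  ∣ (ℤ.+ a -ℤ ℤ.+ n) -ℤ (ℤ.+ b -ℤ ℤ.+ n) ∣ ≤ A + B
∣vec-vec∣≤ a b n A B a≤b+A b≤a+B rewrite vec-difference a b n | ℤₚ.m-n≡m⊖n a b with ≤-total b a
... | inj₁ b≤a rewrite ℤₚ.⊖-≥ b≤a = ≤-trans (m≤n+o⇒m∸n≤o a b a≤b+A) (m≤m+n A B)
... | inj₂ a≤b rewrite ℤₚ.⊖-≤ a≤b | ℤₚ.∣-i∣≡∣i∣ (ℤ.+ (b ∸ a)) =
  ≤-trans (m≤n+o⇒m∸n≤o b a b≤a+B) (m≤n+m B A)

sum-indicator-∧-== : ∀ {k} (b : Bool) (x : Fin k) → sum (λ i → indicator (b ∧ (x == i))) ≡ indicator b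
sum-indicator-∧-== {k} false x = sum-zero {k} _ (λ _ → refl)
sum-indicator-∧-== true  x = sum-indicator-== x

∑-countB-by-colour : {A : Set} {k : ℕ} (F : A → Bool) (col : A → Fin k) (xs : List A) →
  sum (λ i → countB (map (λ e → F e ∧ (col e == i)) xs)) ≡ countB (map F xs)
∑-countB-by-colour {k = k} F col []       = sum-zero {k} _ (λ _ → refl)
∑-countB-by-colour {k = k} F col (x ∷ xs) = begin
  sum (λ i → countB (map (λ e → F e ∧ (col e == i)) (x ∷ xs)))
    ≡⟨ sum-cong-≗ (λ i → countB-∷ (F x ∧ (col x == i)) (map (λ e → F e ∧ (col e == i)) xs)) ⟩
  sum (λ i → indicator (F x ∧ (col x == i)) + rest i)
    ≡⟨ ∑-distrib-+ (λ i → indicator (F x ∧ (col x == i))) rest ⟩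
  sum (λ i → indicator (F x ∧ (col x == i))) + sum rest
    ≡⟨ cong₂ _+_ (sum-indicator-∧-== (F x) (col x)) (∑-countB-by-colour F col xs) ⟩
  indicator (F x) + countB (map F xs)
    ≡⟨ sym (countB-∷ (F x) (map F xs)) ⟩
  countB (map F (x ∷ xs)) ∎
  where
  open ≡-Reasoning
  rest : Fin k → ℕ
  rest i = countB (map (λ e → F e ∧ (col e == i)) xs)

module _ {N k : ℕ} (c : Coloring N k) where

  mcol≤ : (E F : EdgeSet N) (i : Fin k) → mcol c E i ≤ mcol c F i + mcol c (E ∖ F) i
  mcol≤ E F i = countB-map-≤-∨ _ _ _ (edgeList N) (λ { (u , v) t → in-F-or-not (E u v) (F u v) (c u v == i) t })
    where
    in-F-or-not : ∀ x y z → (x ∧ z) ≡ true → ((y ∧ z) ∨ ((x ∧ not y) ∧ z)) ≡ true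
    in-F-or-not true true  true _ = refl
    in-F-or-not true false true _ = refl

  ∑-mcol≡numEdges : (E : EdgeSet N) → sum (mcol c E) ≡ numEdges E
  ∑-mcol≡numEdges E = ∑-countB-by-colour (λ e → E (proj₁ e) (proj₂ e)) (λ e → c (proj₁ e) (proj₂ e)) (edgeList N)

  l1dist≤numEdges-∖ : (n : ℕ) (M M′ : EdgeSet N) → l1dist n c M M′ ≤ numEdges (M ∖ M′) + numEdges (M′ ∖ M)
  l1dist≤numEdges-∖ n M M′ = begin
    l1dist n c M M′
      ≡⟨ sumℕ-map-allFin (λ i → ∣ vec n c M i -ℤ vec n c M′ i ∣) ⟩
    sum (λ i → ∣ vec n c M i -ℤ vec n c M′ i ∣)
      ≤⟨ sum-mono (λ i → ∣vec-vec∣≤ (mcol c M i) (mcol c M′ i) n _ _ (mcol≤ M M′ i) (mcol≤ M′ M i)) ⟩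
    sum (λ i → mcol c (M ∖ M′) i + mcol c (M′ ∖ M) i)
      ≡⟨ ∑-distrib-+ (mcol c (M ∖ M′)) (mcol c (M′ ∖ M)) ⟩
    sum (mcol c (M ∖ M′)) + sum (mcol c (M′ ∖ M))
      ≡⟨ cong₂ _+_ (∑-mcol≡numEdges (M ∖ M′)) (∑-mcol≡numEdges (M′ ∖ M)) ⟩
    numEdges (M ∖ M′) + numEdges (M′ ∖ M) ∎
    where open ≤-Reasoning

-- Segments of matched edges and their closing links
alternating : ℕ → List Bool
alternating zero    = []
alternating (suc m) = true ∷ false ∷ alternating m

module _ {A : Set} where

  vertices : List (A × A) → List A
  vertices []             = []
  vertices ((a , b) ∷ ps) = a ∷ b ∷ vertices ps

  linksTo : A → List (A × A) → List (A × A)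
  linksTo z []                         = []
  linksTo z ((a , b) ∷ [])             = (b , z) ∷ []
  linksTo z ((a , b) ∷ (a′ , b′) ∷ ps) = (b , a′) ∷ linksTo z ((a′ , b′) ∷ ps)

  links : List (A × A) → List (A × A)
  links []             = []
  links ((a , b) ∷ ps) = linksTo a ((a , b) ∷ ps)

  interleave : List (A × A) → List (A × A) → List (A × A)
  interleave []       es       = es
  interleave (p ∷ ps) []       = p ∷ ps
  interleave (p ∷ ps) (e ∷ es) = p ∷ e ∷ interleave ps es

  vertices-++ : (xs ys : List (A × A)) → vertices (xs ++ ys) ≡ vertices xs ++ vertices ys
  vertices-++ []             ys = refl
  vertices-++ ((a , b) ∷ xs) ys = cong (λ l → a ∷ b ∷ l) (vertices-++ xs ys)

  vertices-concat : (xss : List (List (A × A))) → vertices (concat xss) ≡ concatMap vertices xss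
  vertices-concat []         = refl
  vertices-concat (xs ∷ xss) = trans (vertices-++ xs (concat xss)) (cong (vertices xs ++_) (vertices-concat xss))

  length-vertices : (ps : List (A × A)) → length (vertices ps) ≡ length ps + length ps
  length-vertices []       = refl
  length-vertices (_ ∷ ps) = cong suc (trans (cong suc (length-vertices ps)) (sym (+-suc (length ps) (length ps))))

  vertices-linksTo : (z a b : A) (ps : List (A × A)) → vertices (linksTo z ((a , b) ∷ ps)) ≡ (b ∷ vertices ps) ++ [ z ]
  vertices-linksTo z a b []               = refl
  vertices-linksTo z a b ((a′ , b′) ∷ ps) = cong (λ l → b ∷ a′ ∷ l) (vertices-linksTo z a′ b′ ps)

  cyclePairs-vertices : (ps : List (A × A)) → cyclePairs (vertices ps) ≡ interleave ps (links ps)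
  cyclePairs-vertices []             = refl
  cyclePairs-vertices ((a , b) ∷ ps) = go a a b ps
    where
    go : (z a b : A) (ps : List (A × A)) →
      zip (a ∷ b ∷ vertices ps) ((b ∷ vertices ps) ++ [ z ]) ≡ interleave ((a , b) ∷ ps) (linksTo z ((a , b) ∷ ps))
    go z a b []               = refl
    go z a b ((a′ , b′) ∷ ps) = cong (λ l → (a , b) ∷ (b , a′) ∷ l) (go z a′ b′ ps)

  length-links : (ps : List (A × A)) → length (links ps) ≡ length ps
  length-links []             = refl
  length-links ((a , b) ∷ ps) = go a ((a , b) ∷ ps)
    where
    go : (z : A) (ps : List (A × A)) → length (linksTo z ps) ≡ length ps
    go z []                         = refl
    go z (_ ∷ [])                   = refl
    go z ((a , b) ∷ (a′ , b′) ∷ ps) = cong suc (go z ((a′ , b′) ∷ ps))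

  length-cyclePairs : (xs : List A) → length (cyclePairs xs) ≡ length xs
  length-cyclePairs []       = refl
  length-cyclePairs (x ∷ xs) = go x xs x
    where
    go : (x : A) (xs : List A) (z : A) → length (zip (x ∷ xs) (xs ++ [ z ])) ≡ suc (length xs)
    go x []       z = refl
    go x (y ∷ ys) z = cong suc (go y ys z)

  ∈-interleave⁻ : {e : A × A} (ps es : List (A × A)) → e ∈ interleave ps es → e ∈ ps ⊎ e ∈ es
  ∈-interleave⁻ []       es       e∈       = inj₂ e∈
  ∈-interleave⁻ (p ∷ ps) []       e∈       = inj₁ e∈
  ∈-interleave⁻ (p ∷ ps) (e ∷ es) (here refl)         = inj₁ (here refl)
  ∈-interleave⁻ (p ∷ ps) (e ∷ es) (there (here refl)) = inj₂ (here refl)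
  ∈-interleave⁻ (p ∷ ps) (e ∷ es) (there (there e∈)) with ∈-interleave⁻ ps es e∈
  ... | inj₁ e∈ps = inj₁ (there e∈ps)
  ... | inj₂ e∈es = inj₂ (there e∈es)

  ∈-interleave⁺ˡ : {e : A × A} (ps es : List (A × A)) → e ∈ ps → e ∈ interleave ps es
  ∈-interleave⁺ˡ (p ∷ ps) []       e∈           = e∈
  ∈-interleave⁺ˡ (p ∷ ps) (e ∷ es) (here refl)  = here refl
  ∈-interleave⁺ˡ (p ∷ ps) (e ∷ es) (there e∈ps) = there (there (∈-interleave⁺ˡ ps es e∈ps))

  ∈-interleave⁺ʳ : {e : A × A} (ps es : List (A × A)) → e ∈ es → e ∈ interleave ps es
  ∈-interleave⁺ʳ []       es       e∈           = e∈
  ∈-interleave⁺ʳ (p ∷ ps) (e ∷ es) (here refl)  = there (here refl)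
  ∈-interleave⁺ʳ (p ∷ ps) (e ∷ es) (there e∈es) = there (there (∈-interleave⁺ʳ ps es e∈es))

  fst∈vertices : {a b : A} {ps : List (A × A)} → (a , b) ∈ ps → a ∈ vertices ps
  fst∈vertices {ps = _ ∷ ps} (here refl) = here refl
  fst∈vertices {ps = _ ∷ ps} (there e∈)  = there (there (fst∈vertices e∈))

  snd∈vertices : {a b : A} {ps : List (A × A)} → (a , b) ∈ ps → b ∈ vertices ps
  snd∈vertices {ps = _ ∷ ps} (here refl) = there (here refl)
  snd∈vertices {ps = _ ∷ ps} (there e∈)  = there (there (snd∈vertices e∈))

  ∈-vertices⁻ : {x : A} (ps : List (A × A)) → x ∈ vertices ps →
    ∃ λ e → e ∈ ps × (proj₁ e ≡ x ⊎ proj₂ e ≡ x)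
  ∈-vertices⁻ ((a , b) ∷ ps) (here refl)         = (a , b) , here refl , inj₁ refl
  ∈-vertices⁻ ((a , b) ∷ ps) (there (here refl)) = (a , b) , here refl , inj₂ refl
  ∈-vertices⁻ ((a , b) ∷ ps) (there (there x∈)) with ∈-vertices⁻ ps x∈
  ... | e , e∈ , at-e = e , there e∈ , at-e

  map-interleave : (g : A × A → Bool) (ps es : List (A × A)) → length es ≡ length ps →
    (∀ {p} → p ∈ ps → g p ≡ true) → (∀ {e} → e ∈ es → g e ≡ false) →
    map g (interleave ps es) ≡ alternating (length ps)
  map-interleave g []       []       _   _ _ = refl
  map-interleave g (p ∷ ps) (e ∷ es) len t f =
    cong₂ _∷_ (t (here refl)) (cong₂ _∷_ (f (here refl)) (map-interleave g ps es (suc-injective len) (t ∘ there) (f ∘ there)))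

cyclePairs-alternating : (P : Bool × Bool → Set) → P (true , false) → P (false , true) →
  ∀ m → All P (cyclePairs (alternating (suc m)))
cyclePairs-alternating P p-tf p-ft = go
  where
  go : ∀ m → All P (zip (true ∷ false ∷ alternating m) ((false ∷ alternating m) ++ [ true ]))
  go zero    = p-tf ∷ p-ft ∷ []
  go (suc m) = p-tf ∷ p-ft ∷ go m

module _ {A : Set} where

  lastFst : A → List (A × A) → A
  lastFst d []             = d
  lastFst d ((a , b) ∷ ps) = lastFst a ps

  lastFst∈vertices : (d : A) (ps : List (A × A)) → ps ≢ [] → lastFst d ps ∈ vertices ps
  lastFst∈vertices d []                          ps≢[] = ⊥-elim (ps≢[] refl)
  lastFst∈vertices d ((a , b) ∷ [])              _     = here refl
  lastFst∈vertices d ((a , b) ∷ (a′ , b′) ∷ ps) _     = there (there (lastFst∈vertices a ((a′ , b′) ∷ ps) (λ ())))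

  links-endpoints : (ps : List (A × A)) → ∀ {x y} → (x , y) ∈ links ps →
    (∃ λ c → (c , x) ∈ ps) × (∃ λ d → (y , d) ∈ ps)
  links-endpoints ((a , b) ∷ ps) l∈ with go a a b ps l∈
    where
    go : (z a b : A) (ps : List (A × A)) → ∀ {x y} → (x , y) ∈ linksTo z ((a , b) ∷ ps) →
      (∃ λ c → (c , x) ∈ (a , b) ∷ ps) × ((∃ λ d → (y , d) ∈ ps) ⊎ y ≡ z)
    go z a b []               (here refl) = (a , here refl) , inj₂ refl
    go z a b ((a′ , b′) ∷ ps) (here refl) = (a , here refl) , inj₁ (b′ , here refl)
    go z a b ((a′ , b′) ∷ ps) (there l∈) with go z a′ b′ ps l∈
    ... | (c , c∈) , inj₁ (d , d∈) = (c , there c∈) , inj₁ (d , there d∈)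
    ... | (c , c∈) , inj₂ y≡z      = (c , there c∈) , inj₂ y≡z
  ... | x-end , inj₁ (d , d∈) = x-end , d , there d∈
  ... | x-end , inj₂ refl     = x-end , b , here refl

module _ {N : ℕ} where

  occ-vertices-links : (y : Fin N) (ps : List (Fin N × Fin N)) → occ y (vertices (links ps)) ≡ occ y (vertices ps)
  occ-vertices-links y []             = refl
  occ-vertices-links y ((a , b) ∷ ps) = begin
    occ y (vertices (linksTo a ((a , b) ∷ ps))) ≡⟨ cong (occ y) (vertices-linksTo a a b ps) ⟩
    occ y ((b ∷ vertices ps) ++ [ a ])          ≡⟨ occ-++ y (b ∷ vertices ps) [ a ] ⟩
    occ y (b ∷ vertices ps) + occ y [ a ]       ≡⟨ +-comm (occ y (b ∷ vertices ps)) _ ⟩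
    occ y [ a ] + occ y (b ∷ vertices ps)       ≡⟨ sym (occ-++ y [ a ] (b ∷ vertices ps)) ⟩
    occ y (a ∷ b ∷ vertices ps) ∎
    where open ≡-Reasoning

  occ-vertices-concatMap-links : (y : Fin N) (pss : List (List (Fin N × Fin N))) →
    occ y (vertices (concatMap links pss)) ≡ occ y (concatMap vertices pss)
  occ-vertices-concatMap-links y []         = refl
  occ-vertices-concatMap-links y (ps ∷ pss) = begin
    occ y (vertices (links ps ++ concatMap links pss))              ≡⟨ cong (occ y) (vertices-++ (links ps) _) ⟩
    occ y (vertices (links ps) ++ vertices (concatMap links pss))   ≡⟨ occ-++ y (vertices (links ps)) _ ⟩
    occ y (vertices (links ps)) + occ y (vertices (concatMap links pss))
      ≡⟨ cong₂ _+_ (occ-vertices-links y ps) (occ-vertices-concatMap-links y pss) ⟩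
    occ y (vertices ps) + occ y (concatMap vertices pss)            ≡⟨ sym (occ-++ y (vertices ps) _) ⟩
    occ y (vertices ps ++ concatMap vertices pss) ∎
    where open ≡-Reasoning

  Distinct-vertices⇒¬loop : {x : Fin N} (ps : List (Fin N × Fin N)) → Distinct (vertices ps) → (x , x) ∉ ps
  Distinct-vertices⇒¬loop ((a , b) ∷ ps) dist (here refl) = Distinct⇒∉ dist (here refl)
  Distinct-vertices⇒¬loop ((a , b) ∷ ps) dist (there x∈) =
    Distinct-vertices⇒¬loop ps (Distinct-∷⁻ (Distinct-∷⁻ dist)) x∈

  Distinct-vertices⇒¬reversed : {x y : Fin N} (ps : List (Fin N × Fin N)) → Distinct (vertices ps) → x ≢ y →
    (x , y) ∈ ps → (y , x) ∈ ps → ⊥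
  Distinct-vertices⇒¬reversed ((a , b) ∷ ps) dist x≢y (here refl) (here eq) = x≢y (cong proj₂ eq)
  Distinct-vertices⇒¬reversed ((a , b) ∷ ps) dist x≢y (here refl) (there yx∈) =
    Distinct⇒∉ dist (there (snd∈vertices yx∈))
  Distinct-vertices⇒¬reversed ((a , b) ∷ ps) dist x≢y (there xy∈) (here refl) =
    Distinct⇒∉ (Distinct-∷⁻ dist) (fst∈vertices xy∈)
  Distinct-vertices⇒¬reversed ((a , b) ∷ ps) dist x≢y (there xy∈) (there yx∈) =
    Distinct-vertices⇒¬reversed ps (Distinct-∷⁻ (Distinct-∷⁻ dist)) x≢y xy∈ yx∈

  lookupPartner : Fin N → List (Fin N × Fin N) → Maybe (Fin N)
  lookupPartner u []            = nothing
  lookupPartner u ((x , y) ∷ L) with u ≟ᶠ x | u ≟ᶠ y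
  ... | yes _ | _     = just y
  ... | no _  | yes _ = just x
  ... | no _  | no _  = lookupPartner u L

  lookupPartner-sound : (u v : Fin N) (L : List (Fin N × Fin N)) → lookupPartner u L ≡ just v → (u , v) ∈ L ⊎ (v , u) ∈ L
  lookupPartner-sound u v ((x , y) ∷ L) found with u ≟ᶠ x | u ≟ᶠ y
  lookupPartner-sound u v ((x , y) ∷ L) refl | yes refl | _     = inj₁ (here refl)
  lookupPartner-sound u v ((x , y) ∷ L) refl | no _  | yes refl = inj₂ (here refl)
  ... | no _ | no _ with lookupPartner-sound u v L found
  ...   | inj₁ uv∈ = inj₁ (there uv∈)
  ...   | inj₂ vu∈ = inj₂ (there vu∈)

  lookupPartner-nothing : (u : Fin N) (L : List (Fin N × Fin N)) → lookupPartner u L ≡ nothing → u ∉ vertices L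
  lookupPartner-nothing u ((x , y) ∷ L) none u∈ with u ≟ᶠ x | u ≟ᶠ y
  lookupPartner-nothing u ((x , y) ∷ L) () u∈ | yes _ | _
  lookupPartner-nothing u ((x , y) ∷ L) () u∈ | no _  | yes _
  ... | no u≢x | no u≢y with u∈
  ...   | here u≡x          = u≢x u≡x
  ...   | there (here u≡y)  = u≢y u≡y
  ...   | there (there u∈L) = lookupPartner-nothing u L none u∈L

  lookupPartner-skip : (u x y : Fin N) (L : List (Fin N × Fin N)) → u ≢ x → u ≢ y →
    lookupPartner u ((x , y) ∷ L) ≡ lookupPartner u L
  lookupPartner-skip u x y L u≢x u≢y with u ≟ᶠ x | u ≟ᶠ y
  ... | yes u≡x | _       = ⊥-elim (u≢x u≡x)
  ... | no _    | yes u≡y = ⊥-elim (u≢y u≡y)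
  ... | no _    | no _    = refl

  lookupPartner-fst : {x y : Fin N} (L : List (Fin N × Fin N)) → Distinct (vertices L) → (x , y) ∈ L →
    lookupPartner x L ≡ just y
  lookupPartner-fst {x} ((x′ , y′) ∷ L) dist (here refl) with x ≟ᶠ x
  ... | yes _  = refl
  ... | no x≢x = ⊥-elim (x≢x refl)
  lookupPartner-fst {x} ((x′ , y′) ∷ L) dist (there xy∈) =
    trans (lookupPartner-skip x x′ y′ L
             (λ { refl → Distinct⇒∉ dist (there (fst∈vertices xy∈)) })
             (λ { refl → Distinct⇒∉ (Distinct-∷⁻ dist) (fst∈vertices xy∈) }))
          (lookupPartner-fst L (Distinct-∷⁻ (Distinct-∷⁻ dist)) xy∈)

  lookupPartner-snd : {x y : Fin N} (L : List (Fin N × Fin N)) → Distinct (vertices L) → (x , y) ∈ L →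
    lookupPartner y L ≡ just x
  lookupPartner-snd {x} {y} ((x′ , y′) ∷ L) dist (here refl) with y ≟ᶠ x | y ≟ᶠ y
  ... | yes refl | _      = refl
  ... | no _     | yes _  = refl
  ... | no _     | no y≢y = ⊥-elim (y≢y refl)
  lookupPartner-snd {y = y} ((x′ , y′) ∷ L) dist (there xy∈) =
    trans (lookupPartner-skip y x′ y′ L
             (λ { refl → Distinct⇒∉ dist (there (snd∈vertices xy∈)) })
             (λ { refl → Distinct⇒∉ (Distinct-∷⁻ dist) (snd∈vertices xy∈) }))
          (lookupPartner-snd L (Distinct-∷⁻ (Distinct-∷⁻ dist)) xy∈)

  Matched : (Fin N → Fin N) → List (Fin N × Fin N) → Set
  Matched p ps = ∀ {c d} → (c , d) ∈ ps → d ≡ p c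

  matched-swap : {p : Fin N → Fin N} → IsFreeInvolution p → ∀ {ps} → Matched p ps → ∀ {c d} → (c , d) ∈ ps → c ≡ p d
  matched-swap I matched e∈ = sym (involution-swap I (sym (matched e∈)))

  links-unmatched : {p : Fin N → Fin N} → IsFreeInvolution p → (ps : List (Fin N × Fin N)) →
    Distinct (vertices ps) → Matched p ps → 2 ≤ length ps → ∀ {x y} → (x , y) ∈ links ps → y ≢ p x
  links-unmatched {p} I ((a , b) ∷ (a′ , b′) ∷ ps) dist matched _ =
    go a a b ((a′ , b′) ∷ ps) dist matched
      (λ { refl → Distinct⇒∉ dist (there (lastFst∈vertices a ((a′ , b′) ∷ ps) (λ ()))) })
    where
    go : (z a b : Fin N) (ps : List (Fin N × Fin N)) → Distinct (vertices ((a , b) ∷ ps)) → Matched p ((a , b) ∷ ps) →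
      z ≢ lastFst a ps → ∀ {x y} → (x , y) ∈ linksTo z ((a , b) ∷ ps) → y ≢ p x
    go z a b []               _    matched z≢last (here refl) z≡pb = z≢last (trans z≡pb (sym (matched-swap I matched (here refl))))
    go z a b ((a′ , b′) ∷ ps) dist matched _      (here refl) a′≡pb =
      Distinct⇒∉ dist (there (here (trans (matched-swap I matched (here refl)) (sym a′≡pb))))
    go z a b ((a′ , b′) ∷ ps) dist matched z≢last (there l∈) =
      go z a′ b′ ps (Distinct-∷⁻ (Distinct-∷⁻ dist)) (matched ∘ there) z≢last l∈
  links-unmatched I (_ ∷ []) _ _ (s≤s ())

  segment-isAltCycle : {p : Fin N → Fin N} → IsFreeInvolution p → (M : EdgeSet N) → (∀ u v → M u v ≡ matchingOf p u v) →
    (ps : List (Fin N × Fin N)) → Distinct (vertices ps) → Matched p ps → 2 ≤ length ps → IsAltCycle M (vertices ps)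
  segment-isAltCycle {p} I M M≡ ps@(_ ∷ rest) dist matched 2≤len = (3≤length , Distinct⇒Unique dist) , alternation
    where
    3≤length : 3 ≤ length (vertices ps)
    3≤length = subst (3 ≤_) (sym (length-vertices ps)) (+-mono-≤ 2≤len (≤-trans (s≤s z≤n) 2≤len))
    inM : Fin N × Fin N → Bool
    inM (a , b) = M a b
    on-matched : ∀ {e} → e ∈ ps → inM e ≡ true
    on-matched {a , b} e∈ = trans (M≡ a b) (trans (cong (p a ==_) (matched e∈)) (==-refl (p a)))
    on-links : ∀ {e} → e ∈ links ps → inM e ≡ false
    on-links {a , b} e∈ = trans (M≡ a b) (≢⇒==-false (λ pa≡b → links-unmatched I ps dist matched 2≤len e∈ (sym pa≡b)))
    pattern-of-M : map inM (cyclePairs (vertices ps)) ≡ alternating (length ps)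
    pattern-of-M = trans (cong (map inM) (cyclePairs-vertices ps))
                         (map-interleave inM ps (links ps) (length-links ps) on-matched on-links)
    Differ : Bool × Bool → Set
    Differ (b , b′) = b ≢ b′
    alternation : All Differ (cyclePairs (map inM (cyclePairs (vertices ps))))
    alternation = subst (λ bs → All Differ (cyclePairs bs)) (sym pattern-of-M)
                        (cyclePairs-alternating Differ (λ ()) (λ ()) (length rest))

-- Orbits of p₂ ∘ p₁
even⊎odd : ∀ a → ∃ λ b → a ≡ b + b ⊎ a ≡ suc (b + b)
even⊎odd zero = 0 , inj₁ refl
even⊎odd (suc a) with even⊎odd a
... | b , inj₁ a≡2b   = b , inj₂ (cong suc a≡2b)
... | b , inj₂ a≡2b+1 = suc b , inj₁ (trans (cong suc a≡2b+1) (cong suc (sym (+-suc b b))))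

module BoundedSearch {P : ℕ → Set} (P? : ∀ n → Dec (P n)) where

  search : ℕ → ℕ → ℕ
  search t zero    = t
  search t (suc f) with P? t
  ... | yes _ = t
  ... | no _  = search (suc t) f

  search-found : ∀ t f s → t ≤ s → s < t + f → P s → P (search t f)
  search-found t zero    s t≤s s<t+0 _ =
    ⊥-elim (<-irrefl refl (≤-trans (s≤s t≤s) (subst (s <_) (+-identityʳ t) s<t+0)))
  search-found t (suc f) s t≤s s<t+f Ps with P? t
  ... | yes Pt = Pt
  ... | no ¬Pt with m≤n⇒m<n∨m≡n t≤s
  ...   | inj₂ refl = ⊥-elim (¬Pt Ps)
  ...   | inj₁ t<s  = search-found (suc t) f s t<s (subst (s <_) (+-suc t f) s<t+f) Ps

  search-minimal : ∀ t f s → t ≤ s → s < search t f → ¬ P s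
  search-minimal t zero    s t≤s s<t _ = <-irrefl refl (≤-trans s<t t≤s)
  search-minimal t (suc f) s t≤s s<r Ps with P? t
  ... | yes _  = <-irrefl refl (≤-trans s<r t≤s)
  ... | no ¬Pt with m≤n⇒m<n∨m≡n t≤s
  ...   | inj₂ refl = ¬Pt Ps
  ...   | inj₁ t<s  = search-minimal (suc t) f s t<s s<r Ps

  search-≥ : ∀ t f → t ≤ search t f
  search-≥ t zero    = ≤-refl
  search-≥ t (suc f) with P? t
  ... | yes _ = ≤-refl
  ... | no _  = ≤-trans (n≤1+n t) (search-≥ (suc t) f)

isChord : ∀ {N} → (Fin N → Fin N) → Fin N × Fin N → Bool
isChord p (x , y) = not (p x == y)

module Orbits {N : ℕ} {p₁ p₂ : Fin N → Fin N} (I₁ : IsFreeInvolution p₁) (I₂ : IsFreeInvolution p₂) where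

  σ : Fin N → Fin N
  σ u = p₂ (p₁ u)

  σ⁻¹ : Fin N → Fin N
  σ⁻¹ u = p₁ (p₂ u)

  σ⁻¹∘σ : ∀ u → σ⁻¹ (σ u) ≡ u
  σ⁻¹∘σ u = trans (cong p₁ (involutive I₂ (p₁ u))) (involutive I₁ u)

  σ-injective : ∀ {a b} → σ a ≡ σ b → a ≡ b
  σ-injective {a} {b} eq = trans (sym (σ⁻¹∘σ a)) (trans (cong σ⁻¹ eq) (σ⁻¹∘σ b))

  walk : ℕ → Fin N → Fin N
  walk zero    x = x
  walk (suc i) x = σ (walk i x)

  walk-suc : ∀ i x → walk (suc i) x ≡ walk i (σ x)
  walk-suc zero    x = refl
  walk-suc (suc i) x = cong σ (walk-suc i x)

  walk-+ : ∀ i j x → walk (i + j) x ≡ walk i (walk j x)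
  walk-+ zero    j x = refl
  walk-+ (suc i) j x = cong σ (walk-+ i j x)

  walk-injective : ∀ i {a b} → walk i a ≡ walk i b → a ≡ b
  walk-injective zero    eq = eq
  walk-injective (suc i) eq = walk-injective i (σ-injective eq)

  walk-∸ : ∀ {i j} x → i ≤ j → walk j x ≡ walk i (walk (j ∸ i) x)
  walk-∸ {i} {j} x i≤j = begin
    walk j x               ≡⟨ cong (λ a → walk a x) (sym (m+[n∸m]≡n i≤j)) ⟩
    walk (i + (j ∸ i)) x   ≡⟨ walk-+ i (j ∸ i) x ⟩
    walk i (walk (j ∸ i) x) ∎
    where open ≡-Reasoning

  walk-p₁ : ∀ i y → walk i (p₁ (walk i y)) ≡ p₁ y
  walk-p₁ zero    y = refl
  walk-p₁ (suc i) y = begin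
    walk (suc i) (p₁ (σ (walk i y))) ≡⟨ walk-suc i _ ⟩
    walk i (σ (p₁ (σ (walk i y))))   ≡⟨ cong (walk i) σ-p₁-σ ⟩
    walk i (p₁ (walk i y))           ≡⟨ walk-p₁ i y ⟩
    p₁ y ∎
    where
    open ≡-Reasoning
    σ-p₁-σ : σ (p₁ (σ (walk i y))) ≡ p₁ (walk i y)
    σ-p₁-σ = trans (cong p₂ (involutive I₁ (p₂ (p₁ (walk i y))))) (involutive I₂ (p₁ (walk i y)))

  -- If p₁ (σⁱ x) = σʲ x then p₁ x = σ^(i+j) x; halving i + j yields a fixed point of p₁ or of p₂.
  p₁-walk≢walk : ∀ i j x → p₁ (walk i x) ≢ walk j x
  p₁-walk≢walk i j x eq with even⊎odd (i + j)
  ... | b , inj₁ i+j≡2b = fixedPointFree I₁ (walk b x) (walk-injective b (begin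
    walk b (p₁ (walk b x)) ≡⟨ walk-p₁ b x ⟩
    p₁ x                   ≡⟨ p₁x≡walk ⟩
    walk (i + j) x         ≡⟨ cong (λ a → walk a x) i+j≡2b ⟩
    walk (b + b) x         ≡⟨ walk-+ b b x ⟩
    walk b (walk b x) ∎))
    where
    open ≡-Reasoning
    p₁x≡walk : p₁ x ≡ walk (i + j) x
    p₁x≡walk = trans (sym (walk-p₁ i x)) (trans (cong (walk i) eq) (sym (walk-+ i j x)))
  ... | b , inj₂ i+j≡2b+1 = fixedPointFree I₂ (p₁ (walk b x)) (sym (walk-injective b (begin
    walk b (p₁ (walk b x))   ≡⟨ walk-p₁ b x ⟩
    p₁ x                     ≡⟨ p₁x≡walk ⟩
    walk (i + j) x           ≡⟨ cong (λ a → walk a x) (trans i+j≡2b+1 (sym (+-suc b b))) ⟩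
    walk (b + suc b) x       ≡⟨ walk-+ b (suc b) x ⟩
    walk b (σ (walk b x)) ∎)))
    where
    open ≡-Reasoning
    p₁x≡walk : p₁ x ≡ walk (i + j) x
    p₁x≡walk = trans (sym (walk-p₁ i x)) (trans (cong (walk i) eq) (sym (walk-+ i j x)))

  walk-returns : ∀ x → ∃ λ d → 1 ≤ d × d ≤ N × walk d x ≡ x
  walk-returns x with pigeonhole (n<1+n N) (λ i → walk (toℕ i) x)
  ... | i , j , i<j , eq =
    toℕ j ∸ toℕ i , m<n⇒0<n∸m i<j ,
    ≤-trans (m∸n≤m (toℕ j) (toℕ i)) (≤-pred (toℕ<n j)) ,
    walk-injective (toℕ i) (sym (trans eq (walk-∸ x (<⇒≤ i<j))))

  module Return (x : Fin N) = BoundedSearch (λ d → walk d x ≟ᶠ x)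

  period : Fin N → ℕ
  period x = Return.search x 1 N

  1≤period : ∀ x → 1 ≤ period x
  1≤period x = Return.search-≥ x 1 N

  walk-period : ∀ x → walk (period x) x ≡ x
  walk-period x with walk-returns x
  ... | d , 1≤d , d≤N , walk-d = Return.search-found x 1 N d 1≤d (s≤s d≤N) walk-d

  walk-injective-below-period : ∀ x i j → i < j → j < period x → walk i x ≢ walk j x
  walk-injective-below-period x i j i<j j<p eq =
    Return.search-minimal x 1 N (j ∸ i) (m<n⇒0<n∸m i<j) (≤-trans (s≤s (m∸n≤m j i)) j<p)
      (walk-injective i (sym (trans eq (walk-∸ x (<⇒≤ i<j)))))

  orbitFrom : Fin N → ℕ → List (Fin N × Fin N)
  orbitFrom x zero    = []
  orbitFrom x (suc m) = (x , p₁ x) ∷ orbitFrom (σ x) m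

  ∈-orbitFrom⁻ : ∀ {e} x m → e ∈ orbitFrom x m → ∃ λ i → i < m × e ≡ (walk i x , p₁ (walk i x))
  ∈-orbitFrom⁻ x (suc m) (here refl) = 0 , s≤s z≤n , refl
  ∈-orbitFrom⁻ x (suc m) (there e∈) with ∈-orbitFrom⁻ (σ x) m e∈
  ... | i , i<m , refl = suc i , s≤s i<m , cong (λ w → (w , p₁ w)) (sym (walk-suc i x))

  ∈-orbitFrom⁺ : ∀ x m i → i < m → (walk i x , p₁ (walk i x)) ∈ orbitFrom x m
  ∈-orbitFrom⁺ x (suc m) zero    _         = here refl
  ∈-orbitFrom⁺ x (suc m) (suc i) (s≤s i<m) =
    there (subst (λ w → (w , p₁ w) ∈ orbitFrom (σ x) m) (sym (walk-suc i x)) (∈-orbitFrom⁺ (σ x) m i i<m))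

  length-orbitFrom : ∀ x m → length (orbitFrom x m) ≡ m
  length-orbitFrom x zero    = refl
  length-orbitFrom x (suc m) = cong suc (length-orbitFrom (σ x) m)

  ∈-vertices-orbitFrom⁻ : ∀ {y} x m → y ∈ vertices (orbitFrom x m) →
    ∃ λ i → i < m × (walk i x ≡ y ⊎ p₁ (walk i x) ≡ y)
  ∈-vertices-orbitFrom⁻ x m y∈ with ∈-vertices⁻ (orbitFrom x m) y∈
  ... | e , e∈ , at-e with ∈-orbitFrom⁻ x m e∈
  ...   | i , i<m , refl = i , i<m , at-e

  Distinct-orbitFrom : ∀ m x → (∀ i j → i < j → j < m → walk i x ≢ walk j x) → Distinct (vertices (orbitFrom x m))
  Distinct-orbitFrom zero    x _     = distinct λ _ → z≤n
  Distinct-orbitFrom (suc m) x inj = Distinct-∷⁺ x∉ (Distinct-∷⁺ p₁x∉ (Distinct-orbitFrom m (σ x) inj′))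
    where
    inj′ : ∀ i j → i < j → j < m → walk i (σ x) ≢ walk j (σ x)
    inj′ i j i<j j<m eq = inj (suc i) (suc j) (s≤s i<j) (s≤s j<m) (trans (walk-suc i x) (trans eq (sym (walk-suc j x))))
    p₁x∉ : p₁ x ∉ vertices (orbitFrom (σ x) m)
    p₁x∉ p₁x∈ with ∈-vertices-orbitFrom⁻ (σ x) m p₁x∈
    ... | i , i<m , inj₁ eq = p₁-walk≢walk 0 (suc i) x (sym (trans (walk-suc i x) eq))
    ... | i , i<m , inj₂ eq = inj 0 (suc i) (s≤s z≤n) (s≤s i<m)
            (sym (trans (walk-suc i x) (trans (sym (involutive I₁ _)) (trans (cong p₁ eq) (involutive I₁ x)))))
    x∉ : x ∉ p₁ x ∷ vertices (orbitFrom (σ x) m)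
    x∉ (here x≡p₁x) = fixedPointFree I₁ x (sym x≡p₁x)
    x∉ (there x∈) with ∈-vertices-orbitFrom⁻ (σ x) m x∈
    ... | i , i<m , inj₁ eq = inj 0 (suc i) (s≤s z≤n) (s≤s i<m) (sym (trans (walk-suc i x) eq))
    ... | i , i<m , inj₂ eq = p₁-walk≢walk (suc i) 0 x (trans (cong p₁ (walk-suc i x)) eq)

  orbit : Fin N → List (Fin N × Fin N)
  orbit x = orbitFrom x (period x)

  Distinct-orbit : ∀ x → Distinct (vertices (orbit x))
  Distinct-orbit x = Distinct-orbitFrom (period x) x (walk-injective-below-period x)

  orbit-matched : ∀ x → Matched p₁ (orbit x)
  orbit-matched x e∈ with ∈-orbitFrom⁻ x (period x) e∈
  ... | i , _ , refl = refl

  period≡suc : ∀ x → ∃ λ m → period x ≡ suc m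
  period≡suc x with period x | 1≤period x
  ... | suc m | _ = m , refl

  2≤length-orbit : ∀ x → p₁ x ≢ p₂ x → 2 ≤ length (orbit x)
  2≤length-orbit x p₁x≢p₂x with period x in eq | 1≤period x
  ... | suc zero | _ =
    ⊥-elim (p₁x≢p₂x (trans (sym (involutive I₂ (p₁ x))) (cong p₂ (subst (λ a → walk a x ≡ x) eq (walk-period x)))))
  ... | suc (suc m) | _ rewrite length-orbitFrom x (suc (suc m)) = s≤s (s≤s z≤n)

  x∈orbit : ∀ x → x ∈ vertices (orbit x)
  x∈orbit x with period x | 1≤period x
  ... | suc m | _ = here refl

  p₂-walk-in-orbit : ∀ x i → i < period x → ∃ λ c → (c , p₂ (walk i x)) ∈ orbit x
  p₂-walk-in-orbit x zero _ with period≡suc x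
  ... | m , p≡1+m = walk m x , subst (λ w → (walk m x , w) ∈ orbit x) p₁-last≡p₂x
                                 (∈-orbitFrom⁺ x (period x) m (subst (m <_) (sym p≡1+m) (n<1+n m)))
    where
    p₁-last≡p₂x : p₁ (walk m x) ≡ p₂ x
    p₁-last≡p₂x = trans (sym (involutive I₂ (p₁ (walk m x))))
                        (cong p₂ (trans (cong (λ a → walk a x) (sym p≡1+m)) (walk-period x)))
  p₂-walk-in-orbit x (suc i) i<p =
    walk i x , subst (λ w → (walk i x , w) ∈ orbit x) (sym (involutive I₂ (p₁ (walk i x))))
                     (∈-orbitFrom⁺ x (period x) i (<-trans (n<1+n i) i<p))

  p₂-fst-in-orbit : ∀ x {a b} → (a , b) ∈ orbit x → ∃ λ c → (c , p₂ a) ∈ orbit x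
  p₂-fst-in-orbit x e∈ with ∈-orbitFrom⁻ x (period x) e∈
  ... | i , i<p , refl = p₂-walk-in-orbit x i i<p

  orbit-closed-p₁ : ∀ x {w} → w ∈ vertices (orbit x) → p₁ w ∈ vertices (orbit x)
  orbit-closed-p₁ x w∈ with ∈-vertices⁻ (orbit x) w∈
  ... | (c , d) , e∈ , inj₁ refl = subst (_∈ vertices (orbit x)) (orbit-matched x e∈) (snd∈vertices e∈)
  ... | (c , d) , e∈ , inj₂ refl =
    subst (_∈ vertices (orbit x)) (matched-swap I₁ (orbit-matched x) e∈) (fst∈vertices e∈)

  orbit-closed-p₂ : ∀ x {w} → w ∈ vertices (orbit x) → p₂ w ∈ vertices (orbit x)
  orbit-closed-p₂ x w∈ with ∈-vertices-orbitFrom⁻ x (period x) w∈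
  ... | i , i<p , inj₁ refl = snd∈vertices (proj₂ (p₂-walk-in-orbit x i i<p))
  ... | i , i<p , inj₂ refl with m≤n⇒m<n∨m≡n i<p
  ...   | inj₁ 1+i<p = fst∈vertices (∈-orbitFrom⁺ x (period x) (suc i) 1+i<p)
  ...   | inj₂ 1+i≡p = subst (_∈ vertices (orbit x)) (sym (trans (cong (λ a → walk a x) 1+i≡p) (walk-period x))) (x∈orbit x)

  walk-back : (S : Fin N → Set) → (∀ w → S w → S (p₁ w)) → (∀ w → S w → S (p₂ w)) → ∀ i z → S (walk i z) → S z
  walk-back S p₁-closed p₂-closed zero    z Sz = Sz
  walk-back S p₁-closed p₂-closed (suc i) z S-walk =
    walk-back S p₁-closed p₂-closed i z (subst S (σ⁻¹∘σ (walk i z)) (p₁-closed _ (p₂-closed _ S-walk)))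

  orbits-meet⇒∈ : ∀ x z {w} → w ∈ vertices (orbit x) → w ∈ vertices (orbit z) → z ∈ vertices (orbit x)
  orbits-meet⇒∈ x z w∈x w∈z with ∈-vertices-orbitFrom⁻ z (period z) w∈z
  ... | i , _ , inj₁ refl = walk-back (_∈ vertices (orbit x)) (λ _ → orbit-closed-p₁ x) (λ _ → orbit-closed-p₂ x) i z w∈x
  ... | i , _ , inj₂ refl = walk-back (_∈ vertices (orbit x)) (λ _ → orbit-closed-p₁ x) (λ _ → orbit-closed-p₂ x) i z
                              (subst (_∈ vertices (orbit x)) (involutive I₁ _) (orbit-closed-p₁ x w∈x))

  Chained : List (Fin N × Fin N) → Set
  Chained []                         = ⊤
  Chained (_ ∷ [])                   = ⊤
  Chained ((a , b) ∷ (a′ , b′) ∷ ps) = a′ ≡ p₂ b × Chained ((a′ , b′) ∷ ps)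

  Chained-orbitFrom : ∀ x m → Chained (orbitFrom x m)
  Chained-orbitFrom x zero          = tt
  Chained-orbitFrom x (suc zero)    = tt
  Chained-orbitFrom x (suc (suc m)) = refl , Chained-orbitFrom (σ x) (suc m)

  Chained-take : ∀ n ps → Chained ps → Chained (take n ps)
  Chained-take zero          ps                         _             = tt
  Chained-take (suc n)       []                         _             = tt
  Chained-take (suc zero)    (_ ∷ ps)                   _             = tt
  Chained-take (suc (suc n)) (_ ∷ [])                   _             = tt
  Chained-take (suc (suc n)) ((a , b) ∷ (a′ , b′) ∷ ps) (linked , ch) = linked , Chained-take (suc n) ((a′ , b′) ∷ ps) ch

  Chained-drop : ∀ n ps → Chained ps → Chained (drop n ps)
  Chained-drop zero    ps       ch = ch
  Chained-drop (suc n) []       _  = tt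
  Chained-drop (suc n) (_ ∷ []) _  = Chained-drop n [] tt
  Chained-drop (suc n) ((a , b) ∷ (a′ , b′) ∷ ps) (_ , ch) = Chained-drop n ((a′ , b′) ∷ ps) ch

  lastSnd : Fin N → List (Fin N × Fin N) → Fin N
  lastSnd d []             = d
  lastSnd d ((a , b) ∷ ps) = lastSnd b ps

  -- Along a chained segment every link but the closing one is an M₂-edge.
  chords-linksTo : ∀ z a b ps → Chained ((a , b) ∷ ps) →
    countB (map (isChord p₂) (linksTo z ((a , b) ∷ ps))) ≡ indicator (isChord p₂ (lastSnd b ps , z))
  chords-linksTo z a b []               _           = trans (countB-∷ (isChord p₂ (b , z)) []) (+-identityʳ _)
  chords-linksTo z a b ((a′ , b′) ∷ ps) (refl , ch) rewrite ==-refl (p₂ b) = chords-linksTo z a′ b′ ps ch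

  chords≤1 : ∀ ps → Chained ps → countB (map (isChord p₂) (links ps)) ≤ 1
  chords≤1 []             _  = z≤n
  chords≤1 ((a , b) ∷ ps) ch = ≤-trans (≤-reflexive (chords-linksTo a a b ps ch)) (indicator≤1 _)

  lastSnd-orbitFrom : ∀ x m → lastSnd (p₁ x) (orbitFrom (σ x) m) ≡ p₁ (walk m x)
  lastSnd-orbitFrom x zero    = refl
  lastSnd-orbitFrom x (suc m) = trans (lastSnd-orbitFrom (σ x) m) (cong p₁ (sym (walk-suc m x)))

  chords-orbit≡0 : ∀ x → countB (map (isChord p₂) (links (orbit x))) ≡ 0
  chords-orbit≡0 x with period x | walk-period x | 1≤period x
  ... | suc m | walk-p≡x | _ = begin
    countB (map (isChord p₂) (links (orbitFrom x (suc m))))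
      ≡⟨ chords-linksTo x x (p₁ x) (orbitFrom (σ x) m) (Chained-orbitFrom x (suc m)) ⟩
    indicator (not (p₂ (lastSnd (p₁ x) (orbitFrom (σ x) m)) == x))
      ≡⟨ cong (λ w → indicator (not (p₂ w == x))) (lastSnd-orbitFrom x m) ⟩
    indicator (not (walk (suc m) x == x))
      ≡⟨ cong (λ w → indicator (not (w == x))) walk-p≡x ⟩
    indicator (not (x == x))
      ≡⟨ cong (indicator ∘ not) (==-refl x) ⟩
    0 ∎
    where open ≡-Reasoning

  orbitVertices : List (Fin N) → List (Fin N)
  orbitVertices = concatMap (vertices ∘ orbit)

  ∈-orbitVertices⁻ : ∀ {y} reps → y ∈ orbitVertices reps → ∃ λ r → r ∈ reps × y ∈ vertices (orbit r)
  ∈-orbitVertices⁻ reps y∈ with ∈ₚ.∈-concat⁻′ (map (vertices ∘ orbit) reps) y∈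
  ... | _ , y∈vs , vs∈ with ∈ₚ.∈-map⁻ (vertices ∘ orbit) vs∈
  ...   | r , r∈ , refl = r , r∈ , y∈vs

  GoodRepresentatives : List (Fin N) → Set
  GoodRepresentatives reps = Distinct (orbitVertices reps) × (∀ {r} → r ∈ reps → p₁ r ≢ p₂ r)

  representatives : List (Fin N) → List (Fin N) → List (Fin N)
  representatives []       acc = acc
  representatives (u ∷ us) acc with p₁ u ≟ᶠ p₂ u | ∉⊎∈ u (orbitVertices acc)
  ... | yes _ | _      = representatives us acc
  ... | no _  | inj₁ _ = representatives us (u ∷ acc)
  ... | no _  | inj₂ _ = representatives us acc

  representatives-good : ∀ us acc → GoodRepresentatives acc → GoodRepresentatives (representatives us acc)
  representatives-good []       acc good = good
  representatives-good (u ∷ us) acc good with p₁ u ≟ᶠ p₂ u | ∉⊎∈ u (orbitVertices acc)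
  ... | yes _   | _      = representatives-good us acc good
  ... | no _    | inj₂ _ = representatives-good us acc good
  ... | no u-moves | inj₁ u∉ = representatives-good us (u ∷ acc)
    (Distinct-++⁺ (vertices (orbit u)) (orbitVertices acc) (Distinct-orbit u) (proj₁ good) new-orbit , moves)
    where
    new-orbit : Disjoint (vertices (orbit u)) (orbitVertices acc)
    new-orbit y y∈u y∈acc with ∈-orbitVertices⁻ acc y∈acc
    ... | r , r∈ , y∈r =
      u∉ (∈ₚ.∈-concat⁺′ (orbits-meet⇒∈ r u y∈r y∈u) (∈ₚ.∈-map⁺ (vertices ∘ orbit) r∈))
    moves : ∀ {r} → r ∈ u ∷ acc → p₁ r ≢ p₂ r
    moves (here refl) = u-moves
    moves (there r∈)  = proj₂ good r∈

  representatives-cover : ∀ us acc u → u ∈ us ⊎ u ∈ orbitVertices acc → p₁ u ≢ p₂ u →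
    u ∈ orbitVertices (representatives us acc)
  representatives-cover []        acc u (inj₂ u∈) _ = u∈
  representatives-cover (u′ ∷ us) acc u u∈ u-moves with p₁ u′ ≟ᶠ p₂ u′ | ∉⊎∈ u′ (orbitVertices acc) | u∈
  ... | yes u′-fixed | _ | inj₁ (here refl) = ⊥-elim (u-moves u′-fixed)
  ... | yes _ | _        | inj₁ (there u∈us) = representatives-cover us acc u (inj₁ u∈us) u-moves
  ... | yes _ | _        | inj₂ u∈acc        = representatives-cover us acc u (inj₂ u∈acc) u-moves
  ... | no _  | inj₁ _   | inj₁ (here refl)  =
    representatives-cover us (u ∷ acc) u (inj₂ (∈ₚ.∈-++⁺ˡ (x∈orbit u))) u-moves
  ... | no _  | inj₁ _   | inj₁ (there u∈us) = representatives-cover us (u′ ∷ acc) u (inj₁ u∈us) u-moves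
  ... | no _  | inj₁ _   | inj₂ u∈acc        =
    representatives-cover us (u′ ∷ acc) u (inj₂ (∈ₚ.∈-++⁺ʳ (vertices (orbit u′)) u∈acc)) u-moves
  ... | no _  | inj₂ u′∈ | inj₁ (here refl)  = representatives-cover us acc u (inj₂ u′∈) u-moves
  ... | no _  | inj₂ _   | inj₁ (there u∈us) = representatives-cover us acc u (inj₁ u∈us) u-moves
  ... | no _  | inj₂ _   | inj₂ u∈acc        = representatives-cover us acc u (inj₂ u∈acc) u-moves

-- Cutting, grouping and the thresholds Q and h
sumℕ-++ : (xs ys : List ℕ) → sumℕ (xs ++ ys) ≡ sumℕ xs + sumℕ ys
sumℕ-++ []       ys = refl
sumℕ-++ (x ∷ xs) ys = trans (cong (x +_) (sumℕ-++ xs ys)) (sym (+-assoc x _ _))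

module _ {A : Set} where

  ∑_[_] : (List A → ℕ) → List (List A) → ℕ
  ∑ μ [ xss ] = sumℕ (map μ xss)

  size : List (List A) → ℕ
  size xss = ∑ length [ xss ]

  ∑-++ : (μ : List A → ℕ) (xss yss : List (List A)) → ∑ μ [ xss ++ yss ] ≡ ∑ μ [ xss ] + ∑ μ [ yss ]
  ∑-++ μ xss yss = trans (cong sumℕ (Listₚ.map-++ μ xss yss)) (sumℕ-++ (map μ xss) (map μ yss))

  ∑-additive : (μ : List A → ℕ) → μ [] ≡ 0 → (∀ xs ys → μ (xs ++ ys) ≡ μ xs + μ ys) →
    ∀ xss → ∑ μ [ xss ] ≡ μ (concat xss)
  ∑-additive μ μ[] μ++ []         = sym μ[]
  ∑-additive μ μ[] μ++ (xs ∷ xss) = trans (cong (μ xs +_) (∑-additive μ μ[] μ++ xss)) (sym (μ++ xs (concat xss)))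

  size≡length-concat : ∀ xss → size xss ≡ length (concat xss)
  size≡length-concat = ∑-additive length refl (λ xs ys → Listₚ.length-++ xs)

module Cutting {A : Set} (Q h : ℕ) (h≤Q : h ≤ Q) (1≤h : 1 ≤ h) (2h≤1+Q : h + h ≤ suc Q) where

  cut : ℕ → List A → List (List A)
  cut zero    os = [ os ]
  cut (suc f) os with length os ≤? Q
  ... | yes _ = [ os ]
  ... | no _  = take h os ∷ cut f (drop h os)

  concat-cut : ∀ f os → concat (cut f os) ≡ os
  concat-cut zero    os = Listₚ.++-identityʳ os
  concat-cut (suc f) os with length os ≤? Q
  ... | yes _ = Listₚ.++-identityʳ os
  ... | no _  = trans (cong (take h os ++_) (concat-cut f (drop h os))) (Listₚ.take++drop≡id h os)

  cut-short : ∀ f os → length os ≤ f + Q → ∀ {c} → c ∈ cut f os → length c ≤ Q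
  cut-short zero    os os≤Q (here refl) = os≤Q
  cut-short (suc f) os os≤ c∈ with length os ≤? Q
  cut-short (suc f) os os≤ (here refl) | yes os≤Q = os≤Q
  ... | no _ with c∈
  ...   | here refl = ≤-trans (≤-reflexive (Listₚ.length-take h os)) (≤-trans (m⊓n≤m h _) h≤Q)
  ...   | there c∈′ = cut-short f (drop h os) rest≤ c∈′
    where
    rest≤ : length (drop h os) ≤ f + Q
    rest≤ = ≤-trans (≤-reflexive (Listₚ.length-drop h os))
              (≤-trans (∸-monoˡ-≤ h os≤) (∸-monoʳ-≤ (suc f + Q) 1≤h))

  -- Only lists longer than Q ≥ 2h - 1 are cut, so a remainder never drops below h.
  cut-whole-or-long : ∀ f os → ∀ {c} → c ∈ cut f os → c ≡ os ⊎ h ≤ length c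
  cut-whole-or-long zero    os (here refl) = inj₁ refl
  cut-whole-or-long (suc f) os c∈ with length os ≤? Q
  cut-whole-or-long (suc f) os (here refl) | yes _ = inj₁ refl
  ... | no os≰Q with c∈
  ...   | here refl = inj₂ (≤-reflexive (sym (trans (Listₚ.length-take h os)
                                (m≤n⇒m⊓n≡m (≤-trans h≤Q (<⇒≤ (≰⇒> os≰Q)))))))
  ...   | there c∈′ with cut-whole-or-long f (drop h os) c∈′
  ...     | inj₂ h≤c  = inj₂ h≤c
  ...     | inj₁ refl = inj₂ (≤-trans h≤rest (≤-reflexive (sym (Listₚ.length-drop h os))))
    where
    h≤rest : h ≤ length os ∸ h
    h≤rest = ≤-trans (≤-reflexive (sym (m+n∸n≡m h h)))
                        (∸-monoˡ-≤ h (≤-trans 2h≤1+Q (≰⇒> os≰Q)))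

  cut-preserves : (P : List A → Set) → (∀ n xs → P xs → P (take n xs)) → (∀ n xs → P xs → P (drop n xs)) →
    ∀ f os → P os → ∀ {c} → c ∈ cut f os → P c
  cut-preserves P P-take P-drop zero    os Pos (here refl) = Pos
  cut-preserves P P-take P-drop (suc f) os Pos c∈ with length os ≤? Q
  cut-preserves P P-take P-drop (suc f) os Pos (here refl) | yes _ = Pos
  ... | no _ with c∈
  ...   | here refl = P-take h os Pos
  ...   | there c∈′ = cut-preserves P P-take P-drop f (drop h os) (P-drop h os Pos) c∈′

  pieces : List A → List (List A)
  pieces os = cut (length os) os

  concat-pieces : ∀ os → concat (pieces os) ≡ os
  concat-pieces os = concat-cut (length os) os

  pieces-short : ∀ os {c} → c ∈ pieces os → length c ≤ Q
  pieces-short os = cut-short (length os) os (m≤m+n _ _)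

  pieces-whole-or-long : ∀ os {c} → c ∈ pieces os → c ≡ os ⊎ h ≤ length c
  pieces-whole-or-long os = cut-whole-or-long (length os) os

  pieces-preserve : (P : List A → Set) → (∀ n xs → P xs → P (take n xs)) → (∀ n xs → P xs → P (drop n xs)) →
    ∀ os → P os → ∀ {c} → c ∈ pieces os → P c
  pieces-preserve P P-take P-drop os = cut-preserves P P-take P-drop (length os) os

  ∈-pieces⇒∈ : ∀ os {c x} → c ∈ pieces os → x ∈ c → x ∈ os
  ∈-pieces⇒∈ os c∈ x∈c = subst (_ ∈_) (concat-pieces os) (∈ₚ.∈-concat⁺′ x∈c c∈)

module Grouping {A : Set} (Q h : ℕ) (h≤Q : h ≤ Q) (2h≤1+Q : h + h ≤ suc Q) where

  group : List (List A) → List (List A) → List (List (List A))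
  group []       cur = [ cur ]
  group (p ∷ ps) cur with h ≤? length p | h ≤? size cur + length p
  ... | yes _ | _     = [ p ] ∷ group ps cur
  ... | no _  | yes _ = (p ∷ cur) ∷ group ps []
  ... | no _  | no _  = group ps (p ∷ cur)

  group-∑ : (μ : List A → ℕ) → ∀ ps cur → ∑ μ [ concat (group ps cur) ] ≡ ∑ μ [ ps ] + ∑ μ [ cur ]
  group-∑ μ []       cur = cong (∑ μ [_]) (Listₚ.++-identityʳ cur)
  group-∑ μ (p ∷ ps) cur with h ≤? length p | h ≤? size cur + length p
  ... | yes _ | _     = trans (cong (μ p +_) (group-∑ μ ps cur)) (sym (+-assoc (μ p) _ _))
  ... | no _  | yes _ = begin
    μ p + ∑ μ [ cur ++ concat (group ps []) ]           ≡⟨ cong (μ p +_) (∑-++ μ cur (concat (group ps []))) ⟩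
    μ p + (∑ μ [ cur ] + ∑ μ [ concat (group ps []) ])  ≡⟨ cong (λ s → μ p + (∑ μ [ cur ] + s)) (group-∑ μ ps []) ⟩
    μ p + (∑ μ [ cur ] + (∑ μ [ ps ] + 0))              ≡⟨ rearrange (μ p) (∑ μ [ ps ]) (∑ μ [ cur ]) ⟩
    μ p + ∑ μ [ ps ] + ∑ μ [ cur ] ∎
    where
    open ≡-Reasoning
    rearrange : ∀ a b c → a + (c + (b + 0)) ≡ a + b + c
    rearrange a b c rewrite +-identityʳ b = trans (cong (a +_) (+-comm c b)) (sym (+-assoc a b c))
  ... | no _  | no _  = trans (group-∑ μ ps (p ∷ cur)) (trans (x∙yz≈y∙xz (∑ μ [ ps ]) (μ p) _) (sym (+-assoc (μ p) _ _)))

  ∈-group⁻ : ∀ ps cur {x} → x ∈ concat (group ps cur) → x ∈ ps ⊎ x ∈ cur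
  ∈-group⁻ []       cur x∈ = inj₂ (subst (_ ∈_) (Listₚ.++-identityʳ cur) x∈)
  ∈-group⁻ (p ∷ ps) cur x∈ with h ≤? length p | h ≤? size cur + length p
  ... | yes _ | _ with x∈
  ...   | here refl = inj₁ (here refl)
  ...   | there x∈′ with ∈-group⁻ ps cur x∈′
  ...     | inj₁ x∈ps  = inj₁ (there x∈ps)
  ...     | inj₂ x∈cur = inj₂ x∈cur
  ∈-group⁻ (p ∷ ps) cur x∈ | no _ | yes _ with ∈ₚ.∈-++⁻ (p ∷ cur) x∈
  ... | inj₁ (here refl)  = inj₁ (here refl)
  ... | inj₁ (there x∈cur) = inj₂ x∈cur
  ... | inj₂ x∈′ with ∈-group⁻ ps [] x∈′
  ...   | inj₁ x∈ps = inj₁ (there x∈ps)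
  ∈-group⁻ (p ∷ ps) cur x∈ | no _ | no _ with ∈-group⁻ ps (p ∷ cur) x∈
  ... | inj₁ x∈ps          = inj₁ (there x∈ps)
  ... | inj₂ (here refl)   = inj₁ (here refl)
  ... | inj₂ (there x∈cur) = inj₂ x∈cur

  ∈-group⁺ : ∀ ps cur {x} → x ∈ ps ⊎ x ∈ cur → x ∈ concat (group ps cur)
  ∈-group⁺ []       cur (inj₂ x∈cur) = subst (_ ∈_) (sym (Listₚ.++-identityʳ cur)) x∈cur
  ∈-group⁺ (p ∷ ps) cur x∈ with h ≤? length p | h ≤? size cur + length p | x∈
  ... | yes _ | _     | inj₁ (here refl)   = here refl
  ... | yes _ | _     | inj₁ (there x∈ps)  = there (∈-group⁺ ps cur (inj₁ x∈ps))
  ... | yes _ | _     | inj₂ x∈cur         = there (∈-group⁺ ps cur (inj₂ x∈cur))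
  ... | no _  | yes _ | inj₁ (here refl)   = here refl
  ... | no _  | yes _ | inj₁ (there x∈ps)  = ∈ₚ.∈-++⁺ʳ (p ∷ cur) (∈-group⁺ ps [] (inj₁ x∈ps))
  ... | no _  | yes _ | inj₂ x∈cur         = there (∈ₚ.∈-++⁺ˡ x∈cur)
  ... | no _  | no _  | inj₁ (here refl)   = ∈-group⁺ ps (p ∷ cur) (inj₂ (here refl))
  ... | no _  | no _  | inj₁ (there x∈ps)  = ∈-group⁺ ps (p ∷ cur) (inj₁ x∈ps)
  ... | no _  | no _  | inj₂ x∈cur         = ∈-group⁺ ps (p ∷ cur) (inj₂ (there x∈cur))

  group-size≤ : ∀ ps cur → (∀ {p} → p ∈ ps → length p ≤ Q) → size cur < h →
    ∀ {G} → G ∈ group ps cur → size G ≤ Q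
  group-size≤ []       cur _     cur<h (here refl) = ≤-trans (<⇒≤ cur<h) h≤Q
  group-size≤ (p ∷ ps) cur short cur<h G∈ with h ≤? length p | h ≤? size cur + length p | G∈
  ... | yes _ | _ | here refl = ≤-trans (≤-reflexive (+-identityʳ _)) (short (here refl))
  ... | yes _ | _ | there G∈′ = group-size≤ ps cur (short ∘ there) cur<h G∈′
  ... | no p<h | yes _ | here refl = ≤-pred (begin
    suc (length p + size cur) ≡⟨ sym (+-suc (length p) (size cur)) ⟩
    length p + suc (size cur) ≤⟨ +-mono-≤ (<⇒≤ (≰⇒> p<h)) cur<h ⟩
    h + h                     ≤⟨ 2h≤1+Q ⟩
    suc Q ∎)
    where open ≤-Reasoning
  ... | no _ | yes _ | there G∈′ = group-size≤ ps [] (short ∘ there) (≤-trans (s≤s z≤n) cur<h) G∈′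
  ... | no _ | no p+cur≱h | G∈′ = group-size≤ ps (p ∷ cur) (short ∘ there)
          (subst (_< h) (+-comm (size cur) (length p)) (≰⇒> p+cur≱h)) G∈′

  -- Every group but the last has size at least h.
  group-count : ∀ ps cur → h * length (group ps cur) ≤ size ps + size cur + h
  group-count []       cur = ≤-trans (≤-reflexive (*-identityʳ h)) (m≤n+m h _)
  group-count (p ∷ ps) cur with h ≤? length p | h ≤? size cur + length p
  ... | yes h≤p | _ = begin
    h * suc (length (group ps cur))         ≡⟨ *-suc h _ ⟩
    h + h * length (group ps cur)           ≤⟨ +-mono-≤ h≤p (group-count ps cur) ⟩
    length p + (size ps + size cur + h)     ≡⟨ solve 4 (λ a b c d → a :+ (b :+ c :+ d) := a :+ b :+ c :+ d) refl
                                                       (length p) (size ps) (size cur) h ⟩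
    length p + size ps + size cur + h ∎
    where
    open ≤-Reasoning
    open +-*-Solver
  ... | no _ | yes h≤cur+p = begin
    h * suc (length (group ps []))          ≡⟨ *-suc h _ ⟩
    h + h * length (group ps [])            ≤⟨ +-mono-≤ h≤cur+p (group-count ps []) ⟩
    size cur + length p + (size ps + 0 + h) ≡⟨ solve 4 (λ a b c d → c :+ a :+ (b :+ con 0 :+ d) := a :+ b :+ c :+ d) refl
                                                       (length p) (size ps) (size cur) h ⟩
    length p + size ps + size cur + h ∎
    where
    open ≤-Reasoning
    open +-*-Solver
  ... | no _ | no _ = begin
    h * length (group ps (p ∷ cur))         ≤⟨ group-count ps (p ∷ cur) ⟩
    size ps + (length p + size cur) + h     ≡⟨ solve 4 (λ a b c d → b :+ (a :+ c) :+ d := a :+ b :+ c :+ d) refl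
                                                       (length p) (size ps) (size cur) h ⟩
    length p + size ps + size cur + h ∎
    where
    open ≤-Reasoning
    open +-*-Solver

n≤n*n : ∀ n → n ≤ n * n
n≤n*n zero    = z≤n
n≤n*n (suc n) = m≤m*n (suc n) (suc n)

halfSqrt : ∀ a → ∃ λ q → 4 * (q * q) ≤ a × a < 4 * (suc q * suc q)
halfSqrt zero = 0 , z≤n , s≤s z≤n
halfSqrt (suc a) with halfSqrt a
... | q , lo , hi with 4 * (suc q * suc q) ≤? suc a
...   | yes lo′ = suc q , lo′ , ≤-trans (s≤s hi) (*-monoʳ-< 4 (*-mono-< (n<1+n (suc q)) (n<1+n (suc q))))
...   | no ¬lo′ = q , ≤-trans lo (n≤1+n a) , ≰⇒> ¬lo′

module Threshold (K : ℕ) (4≤K : 4 ≤ K) where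

  Q : ℕ
  Q = proj₁ (halfSqrt (25 * K))

  4Q²≤25K : 4 * (Q * Q) ≤ 25 * K
  4Q²≤25K = proj₁ (proj₂ (halfSqrt (25 * K)))

  25K<4[1+Q]² : 25 * K < 4 * (suc Q * suc Q)
  25K<4[1+Q]² = proj₂ (proj₂ (halfSqrt (25 * K)))

  5≤Q : 5 ≤ Q
  5≤Q with 5 ≤? Q
  ... | yes 5≤Q = 5≤Q
  ... | no Q≱5 = ⊥-elim (<-irrefl refl (<-≤-trans 25K<4[1+Q]² (≤-trans small (*-monoʳ-≤ 25 4≤K))))
    where
    1+Q≤5 : suc Q ≤ 5
    1+Q≤5 = ≰⇒> Q≱5
    small : 4 * (suc Q * suc Q) ≤ 25 * 4
    small = *-monoʳ-≤ 4 (*-mono-≤ 1+Q≤5 1+Q≤5)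

  h : ℕ
  h = proj₁ (even⊎odd (suc Q))

  Q≤2h : Q ≤ h + h
  Q≤2h with even⊎odd (suc Q)
  ... | _ , inj₁ even = ≤-trans (n≤1+n Q) (≤-reflexive even)
  ... | _ , inj₂ odd  = ≤-reflexive (suc-injective odd)

  2h≤1+Q : h + h ≤ suc Q
  2h≤1+Q with even⊎odd (suc Q)
  ... | _ , inj₁ even = ≤-reflexive (sym even)
  ... | _ , inj₂ odd  = ≤-trans (n≤1+n _) (≤-reflexive (sym odd))

  3≤h : 3 ≤ h
  3≤h with 3 ≤? h
  ... | yes 3≤h = 3≤h
  ... | no h≱3 = ⊥-elim (<-irrefl refl (≤-trans (s≤s 5≤Q) (≤-trans (s≤s Q≤2h) (s≤s (+-mono-≤ h≤2 h≤2)))))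
    where
    h≤2 : h ≤ 2
    h≤2 = ≤-pred (≰⇒> h≱3)

  1≤h : 1 ≤ h
  1≤h = ≤-trans (s≤s z≤n) 3≤h

  h≤Q : h ≤ Q
  h≤Q = ≤-pred (≤-trans (+-monoˡ-≤ h 1≤h) 2h≤1+Q)

  -- With h ≈ (5/4)√K, t·h ≤ K forces t ≤ (4/5)√K.
  t*h≤K⇒t²≤K : ∀ t → t * h ≤ K → t * t ≤ K
  t*h≤K⇒t²≤K t th≤K with t ℕ.≤? h
  ... | yes t≤h = ≤-trans (*-monoʳ-≤ t t≤h) th≤K
  ... | no t≰h = ⊥-elim (<-irrefl refl (<-≤-trans too-big (quadratic h 1≤h)))
    where
    open +-*-Solver
    [1+h]h≤K : suc h * h ≤ K
    [1+h]h≤K = ≤-trans (*-monoˡ-≤ h (≰⇒> t≰h)) th≤K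
    too-big : 25 * (suc h * h) < 4 * (suc (h + h) * suc (h + h))
    too-big = ≤-trans (s≤s (*-monoʳ-≤ 25 [1+h]h≤K))
                (≤-trans 25K<4[1+Q]² (*-monoʳ-≤ 4 (*-mono-≤ (s≤s Q≤2h) (s≤s Q≤2h))))
    quadratic : ∀ h → 1 ≤ h → 4 * (suc (h + h) * suc (h + h)) ≤ 25 * (suc h * h)
    quadratic (suc x) _ = ≤-trans (m≤m+n _ (9 * (x * x) + 27 * x + 14)) (≤-reflexive (solve 1 (λ x →
      con 4 :* ((con 1 :+ (con 1 :+ x :+ (con 1 :+ x))) :* (con 1 :+ (con 1 :+ x :+ (con 1 :+ x))))
        :+ (con 9 :* (x :* x) :+ con 27 :* x :+ con 14)
      := con 25 :* ((con 2 :+ x) :* (con 1 :+ x))) refl x))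

  h*g≤K+h⇒g²≤9K : ∀ g → h * g ≤ K + h → g * g ≤ 9 * K
  h*g≤K+h⇒g²≤9K zero    _ = z≤n
  h*g≤K+h⇒g²≤9K (suc a) h[1+a]≤K+h = begin
    suc a * suc a           ≡⟨ solve 1 (λ a → (con 1 :+ a) :* (con 1 :+ a) := a :* a :+ (a :+ a) :+ con 1) refl a ⟩
    a * a + (a + a) + 1     ≤⟨ +-mono-≤ (+-mono-≤ a²≤K (+-mono-≤ a≤K a≤K)) (≤-trans (s≤s z≤n) 4≤K) ⟩
    K + (K + K) + K         ≤⟨ m≤m+n _ (5 * K) ⟩
    K + (K + K) + K + 5 * K ≡⟨ solve 1 (λ K → K :+ (K :+ K) :+ K :+ con 5 :* K := con 9 :* K) refl K ⟩
    9 * K ∎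
    where
    open ≤-Reasoning
    open +-*-Solver
    ha≤K : h * a ≤ K
    ha≤K = +-cancelˡ-≤ h _ _ (≤-trans (≤-reflexive (sym (*-suc h a)))
                                  (≤-trans h[1+a]≤K+h (≤-reflexive (+-comm K h))))
    a²≤K : a * a ≤ K
    a²≤K = t*h≤K⇒t²≤K a (≤-trans (≤-reflexive (*-comm a h)) ha≤K)
    a≤K : a ≤ K
    a≤K = ≤-trans (n≤n*n a) a²≤K

sumℕ-map-*-≤ : {B : Set} (f g : B → ℕ) (h : ℕ) (xs : List B) → (∀ {x} → x ∈ xs → f x * h ≤ g x) →
  sumℕ (map f xs) * h ≤ sumℕ (map g xs)
sumℕ-map-*-≤ f g h []       _     = z≤n
sumℕ-map-*-≤ f g h (x ∷ xs) f*h≤g = ≤-trans (≤-reflexive (*-distribʳ-+ h (f x) _))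
  (+-mono-≤ (f*h≤g (here refl)) (sumℕ-map-*-≤ f g h xs (f*h≤g ∘ there)))

half≤ : ∀ {a b} → a + a ≤ b + b → a ≤ b
half≤ {a} {b} a+a≤b+b with a ≤? b
... | yes a≤b = a≤b
... | no a≰b  = ⊥-elim (<-irrefl refl (<-≤-trans (+-mono-< b<a b<a) a+a≤b+b))
  where b<a = ≰⇒> a≰b

numEdges-subEdges≤ : ∀ {N} (C : Subgraph N) → numEdges (subEdges C) ≤ length (subVertices C)
numEdges-subEdges≤ C = ≤-trans (numEdges≤cover (subEdges C) (concatMap cyclePairs C) covered) (≤-reflexive (length-pairs C))
  where
  covered : ∀ u v → subEdges C u v ≡ true → ∃ λ e → e ∈ concatMap cyclePairs C × joins e u v ≡ true
  covered u v uv∈ with any-true⁻ _ C uv∈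
  ... | cyc , cyc∈ , uv∈cyc with any-true⁻ _ (cyclePairs cyc) uv∈cyc
  ...   | (a , b) , e∈ , joins-e = (a , b) , ∈ₚ.∈-concat⁺′ e∈ (∈ₚ.∈-map⁺ cyclePairs cyc∈) , joins-e
  length-pairs : ∀ C → length (concatMap cyclePairs C) ≡ length (concat C)
  length-pairs []        = refl
  length-pairs (cyc ∷ C) = trans (Listₚ.length-++ (cyclePairs cyc))
    (trans (cong₂ _+_ (length-cyclePairs cyc) (length-pairs C)) (sym (Listₚ.length-++ cyc)))

Segment : ℕ → Set
Segment N = List (Fin N × Fin N)

module Recombination {N : ℕ} {p₁ : Fin N → Fin N} (I₁ : IsFreeInvolution p₁) (Gs : List (List (Segment N)))
  (disjoint-segments : Distinct (concatMap vertices (concat Gs)))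
  (matched : ∀ {ps} → ps ∈ concat Gs → Matched p₁ ps)
  (long : ∀ {ps} → ps ∈ concat Gs → 2 ≤ length ps) where

  segments : List (Segment N)
  segments = concat Gs

  V : List (Fin N)
  V = concatMap vertices segments

  allLinks : List (Fin N × Fin N)
  allLinks = concatMap links segments

  Distinct-allLinks : Distinct (vertices allLinks)
  Distinct-allLinks = distinct λ y → subst (_≤ 1) (sym (occ-vertices-concatMap-links y segments)) (occ≤1 disjoint-segments y)

  Distinct-segment : ∀ {ps} → ps ∈ segments → Distinct (vertices ps)
  Distinct-segment ps∈ = Distinct-concat⁻ (map vertices segments) disjoint-segments (∈ₚ.∈-map⁺ vertices ps∈)

  ∈V⁺ : ∀ {ps x} → ps ∈ segments → x ∈ vertices ps → x ∈ V
  ∈V⁺ ps∈ x∈ = ∈ₚ.∈-concat⁺′ x∈ (∈ₚ.∈-map⁺ vertices ps∈)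

  ∈V⁻ : ∀ {x} → x ∈ V → ∃ λ ps → ps ∈ segments × x ∈ vertices ps
  ∈V⁻ x∈ with ∈ₚ.∈-concat⁻′ (map vertices segments) x∈
  ... | _ , x∈vs , vs∈ with ∈ₚ.∈-map⁻ vertices vs∈
  ...   | ps , ps∈ , refl = ps , ps∈ , x∈vs

  ∈allLinks⁺ : ∀ {ps e} → ps ∈ segments → e ∈ links ps → e ∈ allLinks
  ∈allLinks⁺ ps∈ e∈ = ∈ₚ.∈-concat⁺′ e∈ (∈ₚ.∈-map⁺ links ps∈)

  ∈allLinks⁻ : ∀ {e} → e ∈ allLinks → ∃ λ ps → ps ∈ segments × e ∈ links ps
  ∈allLinks⁻ e∈ with ∈ₚ.∈-concat⁻′ (map links segments) e∈
  ... | _ , e∈ls , ls∈ with ∈ₚ.∈-map⁻ links ls∈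
  ...   | ps , ps∈ , refl = ps , ps∈ , e∈ls

  link-unmatched : ∀ {x y} → (x , y) ∈ allLinks → y ≢ p₁ x
  link-unmatched l∈ with ∈allLinks⁻ l∈
  ... | ps , ps∈ , l∈ps = links-unmatched I₁ ps (Distinct-segment ps∈) (matched ps∈) (long ps∈) l∈ps

  ∈vertices-allLinks⇒∈V : ∀ {x} → x ∈ vertices allLinks → x ∈ V
  ∈vertices-allLinks⇒∈V {x} x∈ =
    occ≥1⇒∈ V (subst (1 ≤_) (occ-vertices-concatMap-links x segments) (∈⇒occ≥1 x∈))

  ∈V⇒∈vertices-allLinks : ∀ {x} → x ∈ V → x ∈ vertices allLinks
  ∈V⇒∈vertices-allLinks {x} x∈ =
    occ≥1⇒∈ (vertices allLinks) (subst (1 ≤_) (sym (occ-vertices-concatMap-links x segments)) (∈⇒occ≥1 x∈))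

  V-closed-p₁ : ∀ {x} → x ∈ V → p₁ x ∈ V
  V-closed-p₁ x∈ with ∈V⁻ x∈
  ... | ps , ps∈ , x∈ps with ∈-vertices⁻ ps x∈ps
  ...   | (c , d) , e∈ , inj₁ refl = ∈V⁺ ps∈ (subst (_∈ vertices ps) (matched ps∈ e∈) (snd∈vertices e∈))
  ...   | (c , d) , e∈ , inj₂ refl =
    ∈V⁺ ps∈ (subst (_∈ vertices ps) (matched-swap I₁ (matched ps∈) e∈) (fst∈vertices e∈))

  -- Along each segment, the matched edges are traded for the links.
  p′ : Fin N → Fin N
  p′ u = fromMaybe (p₁ u) (lookupPartner u allLinks)

  p′-found : ∀ {u v} → lookupPartner u allLinks ≡ just v → p′ u ≡ v
  p′-found found rewrite found = refl

  p′-outside : ∀ {x} → x ∉ V → p′ x ≡ p₁ x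
  p′-outside {x} x∉ with lookupPartner x allLinks in found
  ... | nothing = refl
  ... | just v with lookupPartner-sound x v allLinks found
  ...   | inj₁ xv∈ = ⊥-elim (x∉ (∈vertices-allLinks⇒∈V (fst∈vertices xv∈)))
  ...   | inj₂ vx∈ = ⊥-elim (x∉ (∈vertices-allLinks⇒∈V (snd∈vertices vx∈)))

  link-at : ∀ {x} → x ∈ V → (x , p′ x) ∈ allLinks ⊎ (p′ x , x) ∈ allLinks
  link-at {x} x∈ with lookupPartner x allLinks in found
  ... | just v  = lookupPartner-sound x v allLinks found
  ... | nothing = ⊥-elim (lookupPartner-nothing x allLinks found (∈V⇒∈vertices-allLinks x∈))

  p′-involutive : ∀ u → p′ (p′ u) ≡ u
  p′-involutive u with ∉⊎∈ u V
  ... | inj₂ u∈ with link-at u∈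
  ...   | inj₁ l∈ = p′-found (lookupPartner-snd allLinks Distinct-allLinks l∈)
  ...   | inj₂ l∈ = p′-found (lookupPartner-fst allLinks Distinct-allLinks l∈)
  p′-involutive u | inj₁ u∉ =
    trans (cong p′ (p′-outside u∉))
          (trans (p′-outside (u∉ ∘ subst (_∈ V) (involutive I₁ u) ∘ V-closed-p₁)) (involutive I₁ u))

  p′-fixedPointFree : ∀ u → p′ u ≢ u
  p′-fixedPointFree u p′u≡u with ∉⊎∈ u V
  ... | inj₁ u∉ = fixedPointFree I₁ u (trans (sym (p′-outside u∉)) p′u≡u)
  ... | inj₂ u∈ with link-at u∈
  ...   | inj₁ l∈ = Distinct-vertices⇒¬loop allLinks Distinct-allLinks (subst (λ w → (u , w) ∈ allLinks) p′u≡u l∈)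
  ...   | inj₂ l∈ = Distinct-vertices⇒¬loop allLinks Distinct-allLinks (subst (λ w → (w , u) ∈ allLinks) p′u≡u l∈)

  I′ : IsFreeInvolution p′
  I′ = record { involutive = p′-involutive ; fixedPointFree = p′-fixedPointFree }

  p′≢p₁ : ∀ {x} → x ∈ V → p′ x ≢ p₁ x
  p′≢p₁ {x} x∈ eq with link-at x∈
  ... | inj₁ l∈ = link-unmatched l∈ eq
  ... | inj₂ l∈ = link-unmatched l∈ (sym (trans (cong p₁ eq) (involutive I₁ x)))

  cycles : List (Subgraph N)
  cycles = map (map vertices) Gs

  unionEdges⁻ : ∀ u v → unionEdges cycles u v ≡ true →
    ∃ λ ps → ps ∈ segments × ∃ λ e → e ∈ interleave ps (links ps) × joins e u v ≡ true
  unionEdges⁻ u v uv∈ with any-true⁻ _ cycles uv∈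
  ... | C , C∈ , uv∈C with any-true⁻ _ C uv∈C
  ...   | cyc , cyc∈ , uv∈cyc with any-true⁻ _ (cyclePairs cyc) uv∈cyc
  ...     | (a , b) , e∈ , joins-e with ∈ₚ.∈-map⁻ _ C∈
  ...       | G , G∈ , refl with ∈ₚ.∈-map⁻ _ cyc∈
  ...         | ps , ps∈G , refl =
    ps , ∈ₚ.∈-concat⁺′ ps∈G G∈ , (a , b) , subst ((a , b) ∈_) (cyclePairs-vertices ps) e∈ , joins-e

  unionEdges⁺ : ∀ u v {ps} → ps ∈ segments → ∀ {e} → e ∈ interleave ps (links ps) → joins e u v ≡ true →
    unionEdges cycles u v ≡ true
  unionEdges⁺ u v {ps} ps∈ {e} e∈ joins-e with ∈ₚ.∈-concat⁻′ Gs ps∈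
  ... | G , ps∈G , G∈ =
    any-true⁺ _ (∈ₚ.∈-map⁺ (map vertices) G∈)
      (any-true⁺ _ (∈ₚ.∈-map⁺ vertices ps∈G)
        (any-true⁺ _ (subst (e ∈_) (sym (cyclePairs-vertices ps)) e∈) joins-e))

  unionEdges⇒ : ∀ u v → unionEdges cycles u v ≡ true → u ∈ V × (p₁ u ≡ v ⊎ p′ u ≡ v)
  unionEdges⇒ u v uv∈ with unionEdges⁻ u v uv∈
  ... | ps , ps∈ , (a , b) , e∈ , joins-e with ∈-interleave⁻ ps (links ps) e∈ | joins-true⁻ a b u v joins-e
  ... | inj₁ e∈ps | inj₁ (refl , refl) = ∈V⁺ ps∈ (fst∈vertices e∈ps) , inj₁ (sym (matched ps∈ e∈ps))
  ... | inj₁ e∈ps | inj₂ (refl , refl) =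
    ∈V⁺ ps∈ (snd∈vertices e∈ps) , inj₁ (trans (cong p₁ (matched ps∈ e∈ps)) (involutive I₁ a))
  ... | inj₂ e∈ls | inj₁ (refl , refl) =
    ∈vertices-allLinks⇒∈V (fst∈vertices l∈) , inj₂ (p′-found (lookupPartner-fst allLinks Distinct-allLinks l∈))
    where l∈ = ∈allLinks⁺ ps∈ e∈ls
  ... | inj₂ e∈ls | inj₂ (refl , refl) =
    ∈vertices-allLinks⇒∈V (snd∈vertices l∈) , inj₂ (p′-found (lookupPartner-snd allLinks Distinct-allLinks l∈))
    where l∈ = ∈allLinks⁺ ps∈ e∈ls

  unionEdges⇐ : ∀ u v → u ∈ V → p₁ u ≡ v ⊎ p′ u ≡ v → unionEdges cycles u v ≡ true
  unionEdges⇐ u v u∈ (inj₁ refl) with ∈V⁻ u∈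
  ... | ps , ps∈ , u∈ps with ∈-vertices⁻ ps u∈ps
  ...   | (c , d) , e∈ , inj₁ refl =
    unionEdges⁺ u (p₁ u) ps∈ (∈-interleave⁺ˡ ps (links ps) (subst (λ w → (u , w) ∈ ps) (matched ps∈ e∈) e∈))
                (joins-forward u (p₁ u))
  ...   | (c , d) , e∈ , inj₂ refl =
    unionEdges⁺ u (p₁ u) ps∈
      (∈-interleave⁺ˡ ps (links ps) (subst (λ w → (w , u) ∈ ps) (matched-swap I₁ (matched ps∈) e∈) e∈))
      (joins-backward u (p₁ u))
  unionEdges⇐ u v u∈ (inj₂ refl) with link-at u∈
  ... | inj₁ l∈ with ∈allLinks⁻ l∈
  ...   | ps , ps∈ , l∈ps = unionEdges⁺ u (p′ u) ps∈ (∈-interleave⁺ʳ ps (links ps) l∈ps) (joins-forward u (p′ u))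
  unionEdges⇐ u v u∈ (inj₂ refl) | inj₂ l∈ with ∈allLinks⁻ l∈
  ...   | ps , ps∈ , l∈ps = unionEdges⁺ u (p′ u) ps∈ (∈-interleave⁺ʳ ps (links ps) l∈ps) (joins-backward u (p′ u))

  matchingOf-p′≡xor : ∀ u v → matchingOf p′ u v ≡ matchingOf p₁ u v xor unionEdges cycles u v
  matchingOf-p′≡xor u v with ∉⊎∈ u V
  ... | inj₁ u∉ with unionEdges cycles u v in uv∈
  ...   | true  = ⊥-elim (u∉ (proj₁ (unionEdges⇒ u v uv∈)))
  ...   | false = trans (cong (_== v) (p′-outside u∉)) (sym (xor-identityʳ _))
  matchingOf-p′≡xor u v | inj₂ u∈ with p₁ u ≟ᶠ v
  ... | yes p₁u≡v rewrite unionEdges⇐ u v u∈ (inj₁ p₁u≡v) =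
    ≢⇒==-false (λ p′u≡v → p′≢p₁ u∈ (trans p′u≡v (sym p₁u≡v)))
  ... | no p₁u≢v with p′ u ≟ᶠ v
  ...   | yes p′u≡v rewrite unionEdges⇐ u v u∈ (inj₂ p′u≡v) = refl
  ...   | no p′u≢v with unionEdges cycles u v in uv∈
  ...     | false = refl
  ...     | true with proj₂ (unionEdges⇒ u v uv∈)
  ...       | inj₁ p₁u≡v = ⊥-elim (p₁u≢v p₁u≡v)
  ...       | inj₂ p′u≡v = ⊥-elim (p′u≢v p′u≡v)

  concat-subVertices-cycles : concat (map subVertices cycles) ≡ V
  concat-subVertices-cycles = trans (Listₚ.concat-concat (map (map vertices) Gs)) (cong concat (Listₚ.concat-map Gs))

  Distinct-subVertices-cycles : Distinct (concat (map subVertices cycles))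
  Distinct-subVertices-cycles = subst Distinct (sym concat-subVertices-cycles) disjoint-segments

  cycles-disjoint : AllPairs (λ C D → Disjoint (subVertices C) (subVertices D)) cycles
  cycles-disjoint = AllPairsₚ.map⁻ (Distinct-concat⇒AllPairs (map subVertices cycles) Distinct-subVertices-cycles)

  cycles-isUnionAltCycles : (M₁ : EdgeSet N) → (∀ u v → M₁ u v ≡ matchingOf p₁ u v) → All (IsUnionAltCycles M₁) cycles
  cycles-isUnionAltCycles M₁ M₁≡ = Allₚ.map⁺ (All.tabulate λ G∈ →
    Allₚ.map⁺ (All.tabulate λ ps∈G → let ps∈ = ∈ₚ.∈-concat⁺′ ps∈G G∈ in
      segment-isAltCycle I₁ M₁ M₁≡ _ (Distinct-segment ps∈) (matched ps∈) (long ps∈)) ,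
    Distinct-concat⇒AllPairs (map vertices _)
      (Distinct-concat⁻ (map subVertices cycles) Distinct-subVertices-cycles
        (∈ₚ.∈-map⁺ subVertices (∈ₚ.∈-map⁺ (map vertices) G∈))))

length-subVertices : ∀ {N} (G : List (Segment N)) → length (subVertices (map vertices G)) ≡ size G + size G
length-subVertices G = begin
  length (concat (map vertices G)) ≡⟨ cong length (sym (vertices-concat G)) ⟩
  length (vertices (concat G))     ≡⟨ length-vertices (concat G) ⟩
  length (concat G) + length (concat G) ≡⟨ sym (cong₂ _+_ (size≡length-concat G) (size≡length-concat G)) ⟩
  size G + size G ∎
  where open ≡-Reasoning

module _ {A : Set} (f : A → Bool) where

  ∈-filterᵇ⁺ : ∀ {x xs} → x ∈ xs → f x ≡ true → x ∈ filterᵇ f xs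
  ∈-filterᵇ⁺ {xs = y ∷ xs} (here refl) fx rewrite fx = here refl
  ∈-filterᵇ⁺ {xs = y ∷ xs} (there x∈) fx with f y
  ... | true  = there (∈-filterᵇ⁺ x∈ fx)
  ... | false = ∈-filterᵇ⁺ x∈ fx

  length-filterᵇ : ∀ xs → length (filterᵇ f xs) ≡ countB (map f xs)
  length-filterᵇ []       = refl
  length-filterᵇ (x ∷ xs) with f x
  ... | true  = cong suc (length-filterᵇ xs)
  ... | false = length-filterᵇ xs

not-==⇒≢ : ∀ {N} {x y : Fin N} → not (x == y) ≡ true → x ≢ y
not-==⇒≢ {x = x} ne refl rewrite ==-refl x with ne
... | ()

module Chords {N : ℕ} {p₁ p₂ : Fin N → Fin N} (I₁ : IsFreeInvolution p₁) (I₂ : IsFreeInvolution p₂)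
  (Gs : List (List (Segment N)))
  (disjoint-segments : Distinct (concatMap vertices (concat Gs)))
  (matched : ∀ {ps} → ps ∈ concat Gs → Matched p₁ ps)
  (long : ∀ {ps} → ps ∈ concat Gs → 2 ≤ length ps)
  (agree-outside : ∀ u → u ∉ concatMap vertices (concat Gs) → p₁ u ≡ p₂ u)
  (p₂-head-is-tail : ∀ {a b} → (a , b) ∈ concat (concat Gs) → ∃ λ c → (c , p₂ a) ∈ concat (concat Gs)) where

  open Recombination I₁ Gs disjoint-segments matched long public

  pairs : List (Fin N × Fin N)
  pairs = concat segments

  pair-matched : ∀ {a b} → (a , b) ∈ pairs → b ≡ p₁ a
  pair-matched e∈ with ∈ₚ.∈-concat⁻′ segments e∈
  ... | ps , e∈ps , ps∈ = matched ps∈ e∈ps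

  tail∈V : ∀ {c x} → (c , x) ∈ pairs → x ∈ V
  tail∈V e∈ with ∈ₚ.∈-concat⁻′ segments e∈
  ... | ps , e∈ps , ps∈ = ∈V⁺ ps∈ (snd∈vertices e∈ps)

  ¬head×tail : ∀ {x c d} → (x , d) ∈ pairs → (c , x) ∈ pairs → ⊥
  ¬head×tail {x} {c} xd∈ cx∈ = Distinct-vertices⇒¬reversed pairs Distinct-pairs (fixedPointFree I₁ x ∘ sym) xp₁x∈ p₁xx∈
    where
    Distinct-pairs : Distinct (vertices pairs)
    Distinct-pairs = subst Distinct (sym (vertices-concat segments)) disjoint-segments
    xp₁x∈ : (x , p₁ x) ∈ pairs
    xp₁x∈ = subst (λ w → (x , w) ∈ pairs) (pair-matched xd∈) xd∈
    p₁xx∈ : (p₁ x , x) ∈ pairs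
    p₁xx∈ = subst (λ w → (w , x) ∈ pairs) (matched-swap I₁ pair-matched cx∈) cx∈

  link-from-tail : ∀ {c x} → (c , x) ∈ pairs → (x , p′ x) ∈ allLinks
  link-from-tail cx∈ with link-at (tail∈V cx∈)
  ... | inj₁ l∈ = l∈
  ... | inj₂ l∈ with ∈allLinks⁻ l∈
  ...   | ps , ps∈ , l∈ps with proj₂ (links-endpoints ps l∈ps)
  ...     | d , xd∈ps = ⊥-elim (¬head×tail (∈ₚ.∈-concat⁺′ xd∈ps ps∈) cx∈)

  chords : List (Fin N × Fin N)
  chords = filterᵇ (isChord p₂) allLinks

  chord⁺ : ∀ {x y} → (x , y) ∈ allLinks → p₂ x ≢ y → (x , y) ∈ chords
  chord⁺ l∈ p₂x≢y = ∈-filterᵇ⁺ (isChord p₂) l∈ (cong not (≢⇒==-false p₂x≢y))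

  moved⇒∈V : ∀ {u} → p′ u ≢ p₂ u → u ∈ V
  moved⇒∈V {u} p′u≢p₂u with ∉⊎∈ u V
  ... | inj₂ u∈ = u∈
  ... | inj₁ u∉ = ⊥-elim (p′u≢p₂u (trans (p′-outside u∉) (agree-outside u u∉)))

  chord-at-moved : ∀ u → p′ u ≢ p₂ u → ∃ λ e → e ∈ chords × joins e u (p′ u) ≡ true
  chord-at-moved u p′u≢p₂u with link-at (moved⇒∈V p′u≢p₂u)
  ... | inj₁ l∈ = (u , p′ u) , chord⁺ l∈ (p′u≢p₂u ∘ sym) , joins-forward u (p′ u)
  ... | inj₂ l∈ = (p′ u , u) , chord⁺ l∈ (λ p₂p′u≡u → p′u≢p₂u (sym (involution-swap I₂ p₂p′u≡u))) ,
                  joins-backward u (p′ u)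

  new-edges-are-chords : (M₂ : EdgeSet N) → (∀ u v → M₂ u v ≡ matchingOf p₂ u v) →
    ∀ u v → (matchingOf p′ ∖ M₂) u v ≡ true → ∃ λ e → e ∈ chords × joins e u v ≡ true
  new-edges-are-chords M₂ M₂≡ u v uv∈ with ∧-true⁻ {matchingOf p′ u v} uv∈
  ... | p′u==v , ¬M₂uv with ==⇒≡ p′u==v
  ...   | refl = chord-at-moved u (λ eq → not-==⇒≢ (subst (λ b → not b ≡ true) (M₂≡ u (p′ u)) ¬M₂uv) (sym eq))

  toM₂ : Fin N × Fin N → Fin N × Fin N
  toM₂ (x , y) = (x , p₂ x)

  lost-at-moved : ∀ u → p′ u ≢ p₂ u → ∃ λ e → e ∈ map toM₂ chords × joins e u (p₂ u) ≡ true
  lost-at-moved u p′u≢p₂u with ∈V⁻ (moved⇒∈V p′u≢p₂u)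
  ... | ps , ps∈ , u∈ps with ∈-vertices⁻ ps u∈ps
  ...   | (c , d) , e∈ , inj₂ refl =
    (u , p₂ u) , ∈ₚ.∈-map⁺ toM₂ (chord⁺ (link-from-tail (∈ₚ.∈-concat⁺′ e∈ ps∈)) (p′u≢p₂u ∘ sym)) ,
    joins-forward u (p₂ u)
  ...   | (c , d) , e∈ , inj₁ refl with p₂-head-is-tail (∈ₚ.∈-concat⁺′ e∈ ps∈)
  ...     | _ , tail∈ =
    (p₂ u , p₂ (p₂ u)) , ∈ₚ.∈-map⁺ toM₂ (chord⁺ (link-from-tail tail∈) unmoved) ,
    subst (λ w → joins (p₂ u , w) u (p₂ u) ≡ true) (sym (involutive I₂ u)) (joins-backward u (p₂ u))
    where
    unmoved : p₂ (p₂ u) ≢ p′ (p₂ u)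
    unmoved eq = p′u≢p₂u (involution-swap I′ (sym (trans (sym (involutive I₂ u)) eq)))

  lost-edges-covered : (M₂ : EdgeSet N) → (∀ u v → M₂ u v ≡ matchingOf p₂ u v) →
    ∀ u v → (M₂ ∖ matchingOf p′) u v ≡ true → ∃ λ e → e ∈ map toM₂ chords × joins e u v ≡ true
  lost-edges-covered M₂ M₂≡ u v uv∈ with ∧-true⁻ {M₂ u v} uv∈
  ... | M₂uv , ¬p′uv with ==⇒≡ (trans (sym (M₂≡ u v)) M₂uv)
  ...   | refl = lost-at-moved u (not-==⇒≢ ¬p′uv)

  l1dist≤2chords : ∀ {k} (n : ℕ) (c : Coloring N k) (M₂ : EdgeSet N) → (∀ u v → M₂ u v ≡ matchingOf p₂ u v) →
    l1dist n c M₂ (matchingOf p′) ≤ length chords + length chords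
  l1dist≤2chords n c M₂ M₂≡ = ≤-trans (l1dist≤numEdges-∖ c n M₂ (matchingOf p′)) (+-mono-≤
    (≤-trans (numEdges≤cover _ _ (lost-edges-covered M₂ M₂≡)) (≤-reflexive (Listₚ.length-map toM₂ chords)))
    (numEdges≤cover _ _ (new-edges-are-chords M₂ M₂≡)))

  length-chords : length chords ≡ sumℕ (map (λ ps → countB (map (isChord p₂) (links ps))) segments)
  length-chords = trans (length-filterᵇ (isChord p₂) allLinks) (countB-concatMap (isChord p₂) links segments)

-- The construction in K_{2kn}
module Construction (n k : ℕ) (4≤K : 4 ≤ k * n) {p₁ p₂ : Fin (2 * k * n) → Fin (2 * k * n)}
  (I₁ : IsFreeInvolution p₁) (I₂ : IsFreeInvolution p₂) where

  N K : ℕ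
  N = 2 * k * n
  K = k * n

  N≡K+K : N ≡ K + K
  N≡K+K = solve 2 (λ k n → con 2 :* k :* n := k :* n :+ k :* n) refl k n
    where open +-*-Solver

  open Orbits I₁ I₂
  open Threshold K 4≤K
  open Cutting {Fin N × Fin N} Q h h≤Q 1≤h 2h≤1+Q
  open Grouping {Fin N × Fin N} Q h h≤Q 2h≤1+Q

  reps : List (Fin N)
  reps = representatives (allFin N) []

  reps-good : GoodRepresentatives reps
  reps-good = representatives-good (allFin N) [] (distinct (λ _ → z≤n) , λ ())

  reps-cover : ∀ u → p₁ u ≢ p₂ u → u ∈ orbitVertices reps
  reps-cover u = representatives-cover (allFin N) [] u (inj₁ (∈ₚ.∈-allFin u))

  items : List (Segment N)
  items = concatMap (pieces ∘ orbit) reps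

  Gs : List (List (Segment N))
  Gs = group items []

  concat-items : concat items ≡ concatMap orbit reps
  concat-items = go reps
    where
    go : ∀ rs → concat (concatMap (pieces ∘ orbit) rs) ≡ concatMap orbit rs
    go []       = refl
    go (r ∷ rs) = trans (sym (Listₚ.concat-++ (pieces (orbit r)) _)) (cong₂ _++_ (concat-pieces (orbit r)) (go rs))

  measure-preserved : (μ : Segment N → ℕ) → μ [] ≡ 0 → (∀ xs ys → μ (xs ++ ys) ≡ μ xs + μ ys) →
    μ (concat (concat Gs)) ≡ μ (concatMap orbit reps)
  measure-preserved μ μ[] μ++ = begin
    μ (concat (concat Gs))   ≡⟨ sym (∑-additive μ μ[] μ++ (concat Gs)) ⟩
    ∑ μ [ concat Gs ]        ≡⟨ group-∑ μ items [] ⟩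
    ∑ μ [ items ] + 0        ≡⟨ +-identityʳ _ ⟩
    ∑ μ [ items ]            ≡⟨ ∑-additive μ μ[] μ++ items ⟩
    μ (concat items)         ≡⟨ cong μ concat-items ⟩
    μ (concatMap orbit reps) ∎
    where open ≡-Reasoning

  occ-segments : ∀ y → occ y (concatMap vertices (concat Gs)) ≡ occ y (orbitVertices reps)
  occ-segments y = begin
    occ y (concatMap vertices (concat Gs))   ≡⟨ cong (occ y) (sym (vertices-concat (concat Gs))) ⟩
    occ y (vertices (concat (concat Gs)))    ≡⟨ measure-preserved (occ y ∘ vertices) refl
                                                  (λ xs ys → trans (cong (occ y) (vertices-++ xs ys))
                                                                   (occ-++ y (vertices xs) (vertices ys))) ⟩
    occ y (vertices (concatMap orbit reps))  ≡⟨ cong (occ y) (trans (vertices-concat (map orbit reps))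
                                                                     (cong concat (sym (Listₚ.map-∘ reps)))) ⟩
    occ y (orbitVertices reps) ∎
    where open ≡-Reasoning

  disjoint-segments : Distinct (concatMap vertices (concat Gs))
  disjoint-segments = distinct λ y → subst (_≤ 1) (sym (occ-segments y)) (occ≤1 (proj₁ reps-good) y)

  agree-outside : ∀ u → u ∉ concatMap vertices (concat Gs) → p₁ u ≡ p₂ u
  agree-outside u u∉ with p₁ u ≟ᶠ p₂ u
  ... | yes eq = eq
  ... | no ne  = ⊥-elim (u∉ (occ≥1⇒∈ _ (subst (1 ≤_) (sym (occ-segments u)) (∈⇒occ≥1 (reps-cover u ne)))))

  piece-origin : ∀ {ps} → ps ∈ concat Gs → ∃ λ r → r ∈ reps × ps ∈ pieces (orbit r)
  piece-origin ps∈ with ∈-group⁻ items [] ps∈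
  ... | inj₁ ps∈items with ∈ₚ.∈-concat⁻′ (map (pieces ∘ orbit) reps) ps∈items
  ...   | _ , ps∈pcs , pcs∈ with ∈ₚ.∈-map⁻ (pieces ∘ orbit) pcs∈
  ...     | r , r∈ , refl = r , r∈ , ps∈pcs

  piece∈segments : ∀ {ps r} → r ∈ reps → ps ∈ pieces (orbit r) → ps ∈ concat Gs
  piece∈segments r∈ ps∈ = ∈-group⁺ items [] (inj₁ (∈ₚ.∈-concat⁺′ ps∈ (∈ₚ.∈-map⁺ (pieces ∘ orbit) r∈)))

  matched : ∀ {ps} → ps ∈ concat Gs → Matched p₁ ps
  matched ps∈ e∈ with piece-origin ps∈
  ... | r , _ , ps∈r = orbit-matched r (∈-pieces⇒∈ (orbit r) ps∈r e∈)

  long : ∀ {ps} → ps ∈ concat Gs → 2 ≤ length ps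
  long ps∈ with piece-origin ps∈
  ... | r , r∈ , ps∈r with pieces-whole-or-long (orbit r) ps∈r
  ...   | inj₁ refl = 2≤length-orbit r (proj₂ reps-good r∈)
  ...   | inj₂ h≤ps = ≤-trans (s≤s (s≤s z≤n)) (≤-trans 3≤h h≤ps)

  p₂-head-is-tail : ∀ {a b} → (a , b) ∈ concat (concat Gs) → ∃ λ c → (c , p₂ a) ∈ concat (concat Gs)
  p₂-head-is-tail e∈ with ∈ₚ.∈-concat⁻′ (concat Gs) e∈
  ... | ps , e∈ps , ps∈ with piece-origin ps∈
  ...   | r , r∈ , ps∈r with p₂-fst-in-orbit r (∈-pieces⇒∈ (orbit r) ps∈r e∈ps)
  ...     | c , ce∈ with ∈ₚ.∈-concat⁻′ (pieces (orbit r)) (subst (_ ∈_) (sym (concat-pieces (orbit r))) ce∈)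
  ...       | ps′ , ce∈ps′ , ps′∈r = c , ∈ₚ.∈-concat⁺′ ce∈ps′ (piece∈segments r∈ ps′∈r)

  open Chords I₁ I₂ Gs disjoint-segments matched long agree-outside p₂-head-is-tail public

  length-orbits≤K : length (concatMap orbit reps) ≤ K
  length-orbits≤K = half≤ (begin
    length (concatMap orbit reps) + length (concatMap orbit reps) ≡⟨ sym (length-vertices (concatMap orbit reps)) ⟩
    length (vertices (concatMap orbit reps))                      ≡⟨ cong length (trans (vertices-concat (map orbit reps))
                                                                       (cong concat (sym (Listₚ.map-∘ reps)))) ⟩
    length (orbitVertices reps)                                   ≤⟨ Distinct⇒length≤ _ (proj₁ reps-good) ⟩
    N                                                             ≡⟨ N≡K+K ⟩
    K + K ∎)
    where open ≤-Reasoning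

  size-items≤K : size items ≤ K
  size-items≤K = subst (_≤ K) (sym (trans (size≡length-concat items) (cong length concat-items))) length-orbits≤K

  size-segments≤K : size (concat Gs) ≤ K
  size-segments≤K = subst (_≤ K)
    (sym (trans (size≡length-concat (concat Gs)) (measure-preserved length refl (λ xs _ → Listₚ.length-++ xs))))
    length-orbits≤K

  chordsOf : Segment N → ℕ
  chordsOf ps = countB (map (isChord p₂) (links ps))

  chordsOf*h≤length : ∀ {ps} → ps ∈ concat Gs → chordsOf ps * h ≤ length ps
  chordsOf*h≤length ps∈ with piece-origin ps∈
  ... | r , _ , ps∈r with pieces-whole-or-long (orbit r) ps∈r
  ...   | inj₁ refl = subst (λ m → m * h ≤ length (orbit r)) (sym (chords-orbit≡0 r)) z≤n
  ...   | inj₂ h≤ps =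
    ≤-trans (*-monoˡ-≤ h (chords≤1 _ chained)) (≤-trans (≤-reflexive (*-identityˡ h)) h≤ps)
    where
    chained = pieces-preserve Chained Chained-take Chained-drop (orbit r) (Chained-orbitFrom r (period r)) ps∈r

  chords*h≤K : length chords * h ≤ K
  chords*h≤K = begin
    length chords * h                ≡⟨ cong (_* h) length-chords ⟩
    sumℕ (map chordsOf segments) * h ≤⟨ sumℕ-map-*-≤ chordsOf length h segments chordsOf*h≤length ⟩
    size segments                    ≤⟨ size-segments≤K ⟩
    K ∎
    where open ≤-Reasoning

  square : ∀ x → x ^ 2 ≡ x * x
  square x = cong (x *_) (*-identityʳ x)

  double-square : ∀ x → (x + x) * (x + x) ≡ 4 * (x * x)
  double-square = solve 1 (λ x → (x :+ x) :* (x :+ x) := con 4 :* (x :* x)) refl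
    where open +-*-Solver

  l1dist-bound : (c : Coloring N k) (M₂ : EdgeSet N) → (∀ u v → M₂ u v ≡ matchingOf p₂ u v) →
    l1dist n c M₂ (matchingOf p′) ^ 2 ≤ 4 * k * n
  l1dist-bound c M₂ M₂≡ = begin
    d ^ 2                                    ≡⟨ square d ⟩
    d * d                                    ≤⟨ *-mono-≤ d≤2r d≤2r ⟩
    (length chords + length chords) * (length chords + length chords) ≡⟨ double-square (length chords) ⟩
    4 * (length chords * length chords)      ≤⟨ *-monoʳ-≤ 4 (t*h≤K⇒t²≤K (length chords) chords*h≤K) ⟩
    4 * K                                    ≡⟨ sym (*-assoc 4 k n) ⟩
    4 * k * n ∎
    where
    open ≤-Reasoning
    d = l1dist n c M₂ (matchingOf p′)
    d≤2r = l1dist≤2chords n c M₂ M₂≡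

  length-cycles-bound : length cycles ^ 2 ≤ 9 * k * n
  length-cycles-bound = begin
    length cycles ^ 2  ≡⟨ trans (square (length cycles)) (cong (λ g → g * g) (Listₚ.length-map (map vertices) Gs)) ⟩
    length Gs * length Gs ≤⟨ h*g≤K+h⇒g²≤9K (length Gs)
                               (≤-trans (group-count items [])
                                        (+-monoˡ-≤ h (≤-trans (≤-reflexive (+-identityʳ _)) size-items≤K))) ⟩
    9 * K              ≡⟨ sym (*-assoc 9 k n) ⟩
    9 * k * n ∎
    where open ≤-Reasoning

  items-short : ∀ {ps} → ps ∈ items → length ps ≤ Q
  items-short ps∈ with ∈ₚ.∈-concat⁻′ (map (pieces ∘ orbit) reps) ps∈
  ... | _ , ps∈pcs , pcs∈ with ∈ₚ.∈-map⁻ (pieces ∘ orbit) pcs∈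
  ...   | r , _ , refl = pieces-short (orbit r) ps∈pcs

  cycle-edges-bound : All (λ C → numEdges (subEdges C) ^ 2 ≤ 25 * k * n) cycles
  cycle-edges-bound = Allₚ.map⁺ (All.tabulate λ {G} G∈ → let m = numEdges (subEdges (map vertices G)) in begin
    m ^ 2           ≡⟨ square m ⟩
    m * m           ≤⟨ *-mono-≤ (m≤2Q G∈) (m≤2Q G∈) ⟩
    (Q + Q) * (Q + Q) ≡⟨ double-square Q ⟩
    4 * (Q * Q)     ≤⟨ 4Q²≤25K ⟩
    25 * K          ≡⟨ sym (*-assoc 25 k n) ⟩
    25 * k * n ∎)
    where
    open ≤-Reasoning
    m≤2Q : ∀ {G} → G ∈ Gs → numEdges (subEdges (map vertices G)) ≤ Q + Q
    m≤2Q {G} G∈ = ≤-trans (numEdges-subEdges≤ (map vertices G)) (≤-trans (≤-reflexive (length-subVertices G))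
                    (+-mono-≤ size≤Q size≤Q))
      where size≤Q = group-size≤ items [] items-short 1≤h G∈

lemma6 : (n k : ℕ) → 1 ≤ n → 4 ≤ k →
    (c : Coloring (2 * k * n) k) → OriginInHull (2 * k * n) k n c →
    (M₁ M₂ : EdgeSet (2 * k * n)) → IsPerfectMatching M₁ → IsPerfectMatching M₂ →
    Σ (EdgeSet (2 * k * n)) λ M₂' → Σ (List (Subgraph (2 * k * n))) λ 𝒞 →
      IsPerfectMatching M₂' ×
      AllPairs (λ C D → Disjoint (subVertices C) (subVertices D)) 𝒞 ×
      (∀ u v → M₂' u v ≡ M₁ u v xor unionEdges 𝒞 u v) ×
      l1dist n c M₂ M₂' ^ 2 ≤ 4 * k * n ×
      length 𝒞 ^ 2 ≤ 9 * k * n ×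
      All (λ C → IsUnionAltCycles M₁ C × numEdges (subEdges C) ^ 2 ≤ 25 * k * n) 𝒞
lemma6 n k 1≤n 4≤k c _ M₁ M₂ PM₁ PM₂
  with perfectMatching⇒involution M₁ PM₁ | perfectMatching⇒involution M₂ PM₂
... | p₁ , I₁ , M₁≡ | p₂ , I₂ , M₂≡ =
  matchingOf p′ , cycles ,
  matchingOf-isPerfectMatching I′ ,
  cycles-disjoint ,
  (λ u v → trans (matchingOf-p′≡xor u v) (cong (_xor unionEdges cycles u v) (sym (M₁≡ u v)))) ,
  l1dist-bound c M₂ M₂≡ ,
  length-cycles-bound ,
  All.zip (cycles-isUnionAltCycles M₁ M₁≡ , cycle-edges-bound)
  where open Construction n k (*-mono-≤ 4≤k 1≤n) I₁ I₂
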